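{- Let $n\ge1$ and let $X_1,\ldots,X_n,Y_1,\ldots,Y_n$ be indeterminates. Then \[ \sum_{\sigma\in\mathcal{S}_n}\operatorname{sgn}\sigma\prod_{1\le i\le j\le n}\left(Y_{\sigma(j)}-X_{\sigma(i)}\right)=\det_{1\le i,j\le n}\left(Y_i^j-X_i^j\right). \] -}

module Defs where

open import Level using (Level)
open import Data.Bool using (Bool; true; false; _∧_; if_then_else_; not)
open import Data.Nat using (ℕ; zero; suc)
open import Data.Nat.Base using (_%_)
open import Data.Fin using (Fin; zero; suc; toℕ; _≟_; _<?_; _≤?_)
open import Data.List using (List; []; _∷_; map; concatMap; allFin; filter; length; foldr)
open import Relation.Nullary.Decidable using (⌊_⌋)
open import Algebra.Bundles using (CommutativeRing)

allFuns : (m n : ℕ) → List (Fin m → Fin n)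
allFuns zero    n = (λ ()) ∷ []
allFuns (suc m) n =
  concatMap (λ f → map (λ k → cons k f) (allFin n)) (allFuns m n)
  where
  cons : Fin n → (Fin m → Fin n) → Fin (suc m) → Fin n
  cons k f zero    = k
  cons k f (suc i) = f i

allB : (n : ℕ) → (Fin n → Bool) → Bool
allB n p = foldr (λ i b → p i ∧ b) true (allFin n)

-- σ is injective (hence a bijection of Fin n)
isPerm : {n : ℕ} → (Fin n → Fin n) → Bool
isPerm {n} σ = allB n (λ i → allB n (λ j → not ⌊ σ i ≟ σ j ⌋ ∨' ⌊ i ≟ j ⌋))
  where
  _∨'_ : Bool → Bool → Bool
  true  ∨' _ = true
  false ∨' b = b

Sym : (n : ℕ) → List (Fin n → Fin n)
Sym n = filter (λ σ → T? (isPerm σ)) (allFuns n n)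
  where
  open import Data.Bool using (T)
  open import Relation.Nullary using (Dec; yes; no)
  T? : (b : Bool) → Dec (T b)
  T? true  = yes _
  T? false = no (λ ())

inversions : {n : ℕ} → (Fin n → Fin n) → ℕ
inversions {n} σ =
  length (filter (λ p → ⌊ proj₁ p <? proj₂ p ⌋ ∧? ⌊ σ (proj₂ p) <? σ (proj₁ p) ⌋)
                 (concatMap (λ i → map (λ j → (i , j)) (allFin n)) (allFin n)))
  where
  open import Data.Product using (_×_; _,_; proj₁; proj₂)
  open import Data.Bool using (T)
  open import Relation.Nullary using (Dec; yes; no)
  _∧?_ : (a b : Bool) → Dec (T (a ∧ b))
  true  ∧? true  = yes _
  true  ∧? false = no (λ ())
  false ∧? _     = no (λ ())

module RingDefs {c ℓ : Level} (R : CommutativeRing c ℓ) where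
  open CommutativeRing R

  Σ-list : {A : Set} → List A → (A → Carrier) → Carrier
  Σ-list xs f = foldr (λ a r → f a + r) 0# xs

  Π-list : {A : Set} → List A → (A → Carrier) → Carrier
  Π-list xs f = foldr (λ a r → f a * r) 1# xs

  pow : Carrier → ℕ → Carrier
  pow x zero    = 1#
  pow x (suc k) = x * pow x k

  sgn : {n : ℕ} → (Fin n → Fin n) → Carrier
  sgn σ = if ⌊ inversions σ % 2 Data.Nat.≟ 0 ⌋
            then 1# else - 1#
    where import Data.Nat

  -- Leibniz determinant of an n×n matrix M (M i j = entry in row i, column j)
  det : (n : ℕ) → (Fin n → Fin n → Carrier) → Carrier
  det n M = Σ-list (Sym n) (λ σ → sgn σ * Π-list (allFin n) (λ i → M i (σ i)))

  Π-i≤j : (n : ℕ) → (Fin n → Fin n → Carrier) → Carrier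
  Π-i≤j n f = Π-list (allFin n) (λ i →
                Π-list (filter (λ j → i ≤? j) (allFin n)) (λ j → f i j))

{-# OPTIONS --safe #-}
-- Expanding the left-hand side according to k = σ(1) splits off the factor ∏_l (Y_l − X_k),
-- which depends on k only, and leaves the same expression for the remaining index pairs.
-- Hence, by induction, the left-hand side is the Laplace expansion along a first column
-- q(x) = ∏_l (Y_l − x) of a determinant whose other columns are Y^j − X^j, j < n.
-- Since q(Y_k) = 0, on row k that column equals q(X_k) − q(Y_k), and writing
-- q(x) = (−1)^n x^n + (lower terms) turns it into (−1)^(n+1) (Y_k^n − X_k^n) plus differences
-- of lower powers, which are earlier columns or zero.  Multilinearity and alternation of the
-- column expansion (alternation by expanding twice) leave only the leading part, and moving
-- that column to the end cancels its sign.
module Submission where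

open import Defs
open import Level using (Level; _⊔_)
open import Algebra.Bundles using (CommutativeMonoid; CommutativeRing)
open import Data.Nat.Base as ℕ using (ℕ; zero; suc; _≤_)
import Data.Nat.Properties as ℕ
open import Data.Bool.Base using (Bool; true; false; T; _∧_; if_then_else_)
open import Data.Bool.Properties using (T-∧; ∧-zeroʳ; ∧-identityʳ)
open import Data.Fin.Base using (Fin; zero; suc; toℕ; punchIn; punchOut; _<_)
open import Data.Fin.Properties using (_≟_; _<?_; _≤?_; all?; any?; punchIn-injective; punchInᵢ≢i; punchIn-punchOut; pigeonhole)
open import Data.Vec.Functional using (Vector; insertAt; removeAt; head; tail; init; last) renaming (_∷_ to _◂_)
open import Data.Vec.Functional.Properties using (insertAt-lookup; insertAt-punchIn)
open import Data.List.Base using (List; []; _∷_; _++_; length; map; concatMap; filter; foldr; allFin; tabulate)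
open import Data.List.Relation.Unary.All using (All; []; _∷_)
open import Data.List.Relation.Unary.All.Properties using (tabulate⁺; tabulate⁻)
open import Data.Product.Base using (_×_; _,_; proj₁; proj₂; ∃; Σ-syntax)
open import Data.Empty using (⊥-elim)
open import Function.Base using (_∘_; id; _⟨_⟩_)
open import Function.Bundles using (_⇔_; mk⇔; module Equivalence)
open import Function.Definitions using (Injective)
open import Relation.Unary using (Pred)
open import Relation.Binary.Core using (_Preserves_⟶_; _Preserves₂_⟶_⟶_)
open import Relation.Nullary.Negation using (contradiction)
open import Relation.Nullary.Decidable using (Dec; yes; no; does; ⌊_⌋; map′; _→-dec_; ¬?; _×-dec_; does-⇔; toWitness; fromWitness)
open import Relation.Binary.PropositionalEquality as ≡ using (_≡_; _≢_; _≗_)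

-- Without a decision procedure for 0# ≈ x in R, ring identities with constants are only provable
-- by the solver if coefficients are computed in ℤ and mapped into R.
module IntegerCoefficientSolver {c ℓ : Level} (R : CommutativeRing c ℓ) where
  open import Data.Integer.Base as ℤ using (ℤ; +_; -[1+_]; _⊖_; _◃_; sign; ∣_∣)
  import Data.Integer.Properties as ℤ
  open import Data.Sign.Base as Sign using (Sign)
  open import Data.Maybe.Base using (Maybe; just; nothing)
  open import Algebra.Solver.Ring.AlmostCommutativeRing using (fromCommutativeRing; _-Raw-AlmostCommutative⟶_)
  open CommutativeRing R hiding (zero)
  open import Algebra.Properties.Ring ring using (-‿involutive; -0#≈0#; -‿+-comm; -1*x≈-x)
  open import Algebra.Properties.Semiring.Mult semiring using (×-homo-+; ×1-homo-*) renaming (_×_ to _×ₙ_)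
  open import Algebra.Properties.CommutativeSemigroup +-commutativeSemigroup using () renaming (interchange to +-interchange)
  open import Algebra.Properties.CommutativeSemigroup *-commutativeSemigroup using () renaming (interchange to *-interchange)
  open import Relation.Binary.Reasoning.Setoid setoid

  ⟦_⟧ℤ : ℤ → Carrier
  ⟦ + n ⟧ℤ      = n ×ₙ 1#
  ⟦ -[1+ n ] ⟧ℤ = - (suc n ×ₙ 1#)

  ⟦-⟧ℤ : ∀ i → ⟦ ℤ.- i ⟧ℤ ≈ - ⟦ i ⟧ℤ
  ⟦-⟧ℤ -[1+ n ]    = sym (-‿involutive _)
  ⟦-⟧ℤ (+ zero)    = sym -0#≈0#
  ⟦-⟧ℤ (+ (suc n)) = refl

  private
    1+-cancel-− : ∀ a b → (1# + a) - (1# + b) ≈ a - b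
    1+-cancel-− a b = begin
      (1# + a) + - (1# + b)    ≈⟨ +-congˡ (-‿+-comm 1# b) ⟨
      (1# + a) + (- 1# + - b)  ≈⟨ +-interchange 1# a (- 1#) (- b) ⟩
      (1# - 1#) + (a - b)      ≈⟨ +-congʳ (-‿inverseʳ 1#) ⟩
      0# + (a - b)             ≈⟨ +-identityˡ _ ⟩
      a - b                    ∎

  ⟦⊖⟧ℤ : ∀ m n → ⟦ m ⊖ n ⟧ℤ ≈ m ×ₙ 1# - n ×ₙ 1#
  ⟦⊖⟧ℤ zero    zero    = sym (-‿inverseʳ 0#)
  ⟦⊖⟧ℤ zero    (suc n) = sym (+-identityˡ _)
  ⟦⊖⟧ℤ (suc m) zero    = sym (trans (+-congˡ -0#≈0#) (+-identityʳ _))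
  ⟦⊖⟧ℤ (suc m) (suc n) = begin
    ⟦ suc m ⊖ suc n ⟧ℤ           ≡⟨ ≡.cong ⟦_⟧ℤ (ℤ.[1+m]⊖[1+n]≡m⊖n m n) ⟩
    ⟦ m ⊖ n ⟧ℤ                   ≈⟨ ⟦⊖⟧ℤ m n ⟩
    m ×ₙ 1# - n ×ₙ 1#            ≈⟨ 1+-cancel-− _ _ ⟨
    suc m ×ₙ 1# - suc n ×ₙ 1#    ∎

  ⟦+⟧ℤ : ∀ i j → ⟦ i ℤ.+ j ⟧ℤ ≈ ⟦ i ⟧ℤ + ⟦ j ⟧ℤ
  ⟦+⟧ℤ -[1+ m ] -[1+ n ] = begin
    - (suc (suc (m ℕ.+ n)) ×ₙ 1#)    ≡⟨ ≡.cong (λ k → - (k ×ₙ 1#)) (ℕ.+-suc (suc m) n) ⟨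
    - ((suc m ℕ.+ suc n) ×ₙ 1#)      ≈⟨ -‿cong (×-homo-+ 1# (suc m) (suc n)) ⟩
    - (suc m ×ₙ 1# + suc n ×ₙ 1#)    ≈⟨ -‿+-comm _ _ ⟨
    - (suc m ×ₙ 1#) + - (suc n ×ₙ 1#) ∎
  ⟦+⟧ℤ -[1+ m ] (+ n)    = trans (⟦⊖⟧ℤ n (suc m)) (+-comm _ _)
  ⟦+⟧ℤ (+ m)    -[1+ n ] = ⟦⊖⟧ℤ m (suc n)
  ⟦+⟧ℤ (+ m)    (+ n)    = ×-homo-+ 1# m n

  private
    ⟦_⟧ₛ : Sign → Carrier
    ⟦ Sign.+ ⟧ₛ = 1#
    ⟦ Sign.- ⟧ₛ = - 1#

    ⟦*⟧ₛ : ∀ s t → ⟦ s Sign.* t ⟧ₛ ≈ ⟦ s ⟧ₛ * ⟦ t ⟧ₛ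
    ⟦*⟧ₛ Sign.+ t      = sym (*-identityˡ _)
    ⟦*⟧ₛ Sign.- Sign.+ = sym (*-identityʳ _)
    ⟦*⟧ₛ Sign.- Sign.- = sym (trans (-1*x≈-x _) (-‿involutive _))

    ⟦◃⟧ℤ : ∀ s n → ⟦ s ◃ n ⟧ℤ ≈ ⟦ s ⟧ₛ * (n ×ₙ 1#)
    ⟦◃⟧ℤ s      zero    = sym (zeroʳ _)
    ⟦◃⟧ℤ Sign.+ (suc n) = sym (*-identityˡ _)
    ⟦◃⟧ℤ Sign.- (suc n) = sym (-1*x≈-x _)

    ⟦sign◃∣∣⟧ℤ : ∀ i → ⟦ i ⟧ℤ ≈ ⟦ sign i ⟧ₛ * (∣ i ∣ ×ₙ 1#)
    ⟦sign◃∣∣⟧ℤ (+ n)    = sym (*-identityˡ _)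
    ⟦sign◃∣∣⟧ℤ -[1+ n ] = sym (-1*x≈-x _)

  ⟦*⟧ℤ : ∀ i j → ⟦ i ℤ.* j ⟧ℤ ≈ ⟦ i ⟧ℤ * ⟦ j ⟧ℤ
  ⟦*⟧ℤ i j = begin
    ⟦ (sign i Sign.* sign j) ◃ (∣ i ∣ ℕ.* ∣ j ∣) ⟧ℤ               ≈⟨ ⟦◃⟧ℤ (sign i Sign.* sign j) (∣ i ∣ ℕ.* ∣ j ∣) ⟩
    ⟦ sign i Sign.* sign j ⟧ₛ * ((∣ i ∣ ℕ.* ∣ j ∣) ×ₙ 1#)        ≈⟨ *-cong (⟦*⟧ₛ (sign i) (sign j)) (×1-homo-* ∣ i ∣ ∣ j ∣) ⟩
    (⟦ sign i ⟧ₛ * ⟦ sign j ⟧ₛ) * ((∣ i ∣ ×ₙ 1#) * (∣ j ∣ ×ₙ 1#)) ≈⟨ *-interchange _ _ _ _ ⟩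
    (⟦ sign i ⟧ₛ * (∣ i ∣ ×ₙ 1#)) * (⟦ sign j ⟧ₛ * (∣ j ∣ ×ₙ 1#)) ≈⟨ *-cong (⟦sign◃∣∣⟧ℤ i) (⟦sign◃∣∣⟧ℤ j) ⟨
    ⟦ i ⟧ℤ * ⟦ j ⟧ℤ                                               ∎

  integerMorphism : ℤ.+-*-rawRing -Raw-AlmostCommutative⟶ fromCommutativeRing R
  integerMorphism = record
    { ⟦_⟧ = ⟦_⟧ℤ ; +-homo = ⟦+⟧ℤ ; *-homo = ⟦*⟧ℤ ; -‿homo = ⟦-⟧ℤ
    ; 0-homo = refl ; 1-homo = +-identityʳ 1# }

  ⟦_⟧ℤ≟_ : ∀ i j → Maybe (⟦ i ⟧ℤ ≈ ⟦ j ⟧ℤ)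
  ⟦ i ⟧ℤ≟ j with i ℤ.≟ j
  ... | yes i≡j = just (reflexive (≡.cong ⟦_⟧ℤ i≡j))
  ... | no _    = nothing

  open import Algebra.Solver.Ring ℤ.+-*-rawRing (fromCommutativeRing R) integerMorphism ⟦_⟧ℤ≟_ public
    using (solve; _:+_; _:*_; :-_; _:-_; _:=_; con)

module Injections where
  open ≡ using (refl; sym; trans; cong)
  open import Data.Sum.Base using (_⊎_; inj₁; inj₂)

  Injectiveᶠ : ∀ {m n} → (Fin m → Fin n) → Set
  Injectiveᶠ = Injective _≡_ _≡_

  Avoids : ∀ {m n} → Fin n → (Fin m → Fin n) → Set
  Avoids v g = ∀ i → g i ≢ v

  injective? : ∀ {m n} (f : Fin m → Fin n) → Dec (Injectiveᶠ f)
  injective? f = map′ (λ inj {i} {j} → inj i j) (λ inj i j → inj)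
    (all? λ i → all? λ j → f i ≟ f j →-dec i ≟ j)

  avoids? : ∀ {m n} (v : Fin n) (g : Fin m → Fin n) → Dec (Avoids v g)
  avoids? v g = all? λ i → ¬? (g i ≟ v)

  T-foldr-∧ : ∀ {A : Set} (p : A → Bool) (xs : List A) → T (foldr (λ a b → p a ∧ b) true xs) ⇔ All (T ∘ p) xs
  T-foldr-∧ p []       = mk⇔ (λ _ → []) (λ _ → _)
  T-foldr-∧ p (x ∷ xs) = mk⇔
    (λ t → let px , pxs = to T-∧ t in px ∷ to (T-foldr-∧ p xs) pxs)
    (λ { (px ∷ pxs) → from T-∧ (px , from (T-foldr-∧ p xs) pxs) })
    where open Equivalence

  T-allB : ∀ n (p : Fin n → Bool) → T (allB n p) ⇔ (∀ i → T (p i))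
  T-allB n p = mk⇔ (tabulate⁻ ∘ to (T-foldr-∧ p (allFin n))) (from (T-foldr-∧ p (allFin n)) ∘ tabulate⁺)
    where open Equivalence

  isPerm⇔injective : ∀ {n} (σ : Fin n → Fin n) → T (isPerm σ) ⇔ Injectiveᶠ σ
  isPerm⇔injective {n} σ = mk⇔ sound complete
    where
    open Equivalence
    open import Relation.Nullary.Decidable using (T?)
    open import Data.Fin.Properties using (¬∀⟶∃¬)
    sound : T (isPerm σ) → Injectiveᶠ σ
    sound t {i} {j} σi≡σj with σ i ≟ σ j | i ≟ j | to (T-allB n _) (to (T-allB n _) t i) j
    ... | _        | yes i≡j | _ = i≡j
    ... | no σi≢σj | no _    | _ = contradiction σi≡σj σi≢σj
    complete : Injectiveᶠ σ → T (isPerm σ)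
    complete inj with T? (isPerm σ)
    ... | yes t = t
    ... | no ¬t with ¬∀⟶∃¬ n _ (λ i → T? _) (¬t ∘ from (T-allB n _))
    ...   | i , ¬tᵢ with ¬∀⟶∃¬ n _ (λ j → T? _) (¬tᵢ ∘ from (T-allB n _))
    ...     | j , ¬tᵢⱼ with σ i ≟ σ j | i ≟ j | ¬tᵢⱼ
    ... | no _      | _      | ¬t′ = contradiction _ ¬t′
    ... | yes _     | yes _  | ¬t′ = contradiction _ ¬t′
    ... | yes σi≡σj | no i≢j | _   = contradiction (inj σi≡σj) i≢j

  ◂-≗ : ∀ {A : Set} {m} (u : A) {f g : Fin m → A} → f ≗ g → u ◂ f ≗ u ◂ g
  ◂-≗ u f≗g zero    = refl
  ◂-≗ u f≗g (suc i) = f≗g i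

  insertAt-≗ : ∀ {A : Set} {m} (p : Fin (suc m)) (v : A) {f g : Fin m → A} → f ≗ g → insertAt f p v ≗ insertAt g p v
  insertAt-≗ zero    v f≗g zero    = refl
  insertAt-≗ zero    v f≗g (suc i) = f≗g i
  insertAt-≗ {m = suc m} (suc p) v f≗g zero    = f≗g zero
  insertAt-≗ {m = suc m} (suc p) v f≗g (suc i) = insertAt-≗ p v (f≗g ∘ suc) i

  injective-≗ : ∀ {m n} {f g : Fin m → Fin n} → f ≗ g → Injectiveᶠ f ⇔ Injectiveᶠ g
  injective-≗ f≗g = mk⇔ (λ inj {i} {j} gi≡gj → inj (trans (f≗g i) (trans gi≡gj (sym (f≗g j)))))
                        (λ inj {i} {j} fi≡fj → inj (trans (sym (f≗g i)) (trans fi≡fj (f≗g j))))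

  avoids-≗ : ∀ {m n} (v : Fin n) {f g : Fin m → Fin n} → f ≗ g → Avoids v f ⇔ Avoids v g
  avoids-≗ v f≗g = mk⇔ (λ av i gi≡v → av i (trans (f≗g i) gi≡v)) (λ av i fi≡v → av i (trans (sym (f≗g i)) fi≡v))

  ∘-punchIn-injective : ∀ {m n} (v : Fin (suc n)) (τ : Fin m → Fin n) → Injectiveᶠ (punchIn v ∘ τ) ⇔ Injectiveᶠ τ
  ∘-punchIn-injective v τ = mk⇔ (λ inj {i} {j} τi≡τj → inj (cong (punchIn v) τi≡τj))
                                (λ inj {i} {j} eq → inj (punchIn-injective v _ _ eq))

  insertAt-injective : ∀ {m n} (g : Fin m → Fin n) (p : Fin (suc m)) (v : Fin n) →
                       Injectiveᶠ (insertAt g p v) ⇔ (Avoids v g × Injectiveᶠ g)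
  insertAt-injective g p v = mk⇔ split join
    where
    f = insertAt g p v
    f-punchIn : ∀ j → f (punchIn p j) ≡ g j
    f-punchIn = insertAt-punchIn g p v
    split : Injectiveᶠ f → Avoids v g × Injectiveᶠ g
    split inj = (λ i gi≡v → punchInᵢ≢i p i (inj (trans (f-punchIn i) (trans gi≡v (sym (insertAt-lookup g p v))))))
                , (λ {i} {j} gi≡gj → punchIn-injective p i j (inj (trans (f-punchIn i) (trans gi≡gj (sym (f-punchIn j))))))
    position : ∀ i → i ≡ p ⊎ ∃ λ j → punchIn p j ≡ i
    position i with p ≟ i
    ... | yes p≡i = inj₁ (sym p≡i)
    ... | no p≢i  = inj₂ (punchOut p≢i , punchIn-punchOut p≢i)
    join : Avoids v g × Injectiveᶠ g → Injectiveᶠ f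
    join (av , inj) {a} {b} fa≡fb with position a | position b
    ... | inj₁ refl       | inj₁ refl       = refl
    ... | inj₁ refl       | inj₂ (j , refl) = ⊥-elim (av j (trans (sym (f-punchIn j)) (trans (sym fa≡fb) (insertAt-lookup g p v))))
    ... | inj₂ (i , refl) | inj₁ refl       = ⊥-elim (av i (trans (sym (f-punchIn i)) (trans fa≡fb (insertAt-lookup g p v))))
    ... | inj₂ (i , refl) | inj₂ (j , refl) = cong (punchIn p) (inj (trans (sym (f-punchIn i)) (trans fa≡fb (f-punchIn j))))

  injective⇒hits-zero : ∀ {n} (σ : Fin (suc n) → Fin (suc n)) → Injectiveᶠ σ → ∃ λ k → σ k ≡ zero
  injective⇒hits-zero {n} σ inj with any? (λ k → σ k ≟ zero)
  ... | yes hit = hit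
  ... | no ¬hit =
    let i , j , i<j , eq = pigeonhole (n<1+n n) (λ k → punchOut (misses k))
    in  ⊥-elim (<-irrefl (inj (punchOut-injective (misses i) (misses j) eq)) i<j)
    where
    open import Data.Nat.Properties using (n<1+n)
    open import Data.Fin.Properties using (punchOut-injective; <-irrefl)
    misses : ∀ k → zero ≢ σ k
    misses k 0≡σk = ¬hit (k , sym 0≡σk)

open Injections

module ListSums {c ℓ : Level} (M : CommutativeMonoid c ℓ) where
  open CommutativeMonoid M
  open import Algebra.Properties.CommutativeMonoid.Sum M public
    using (sum; sum-cong-≋; sum-cong-≗; sum-remove; ∑-distrib-+; ∑-comm; sum-replicate-zero)
  open import Relation.Binary.Reasoning.Setoid setoid

  ∑ₗ : {A : Set} → List A → (A → Carrier) → Carrier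
  ∑ₗ xs f = foldr (λ a r → f a ∙ r) ε xs

  when : Bool → Carrier → Carrier
  when b x = if b then x else ε

  sum-zero : ∀ {n} {f : Vector Carrier n} → (∀ i → f i ≈ ε) → sum f ≈ ε
  sum-zero {n} f≈ε = trans (sum-cong-≋ f≈ε) (sum-replicate-zero n)

  sum-single : ∀ {n} (k : Fin (suc n)) (f : Vector Carrier (suc n)) →
               (∀ j → f (punchIn k j) ≈ ε) → sum f ≈ f k
  sum-single k f others≈ε = trans (sum-remove f) (trans (∙-congˡ (sum-zero others≈ε)) (identityʳ _))

  sum-reindex-injective : ∀ {n} (τ : Fin n → Fin n) → Injectiveᶠ τ → (f : Vector Carrier n) → sum (f ∘ τ) ≈ sum f
  sum-reindex-injective {zero}  τ inj f = refl
  sum-reindex-injective {suc n} τ inj f = begin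
    f (τ zero) ∙ sum (f ∘ τ ∘ suc)                  ≡⟨ ≡.cong (f (τ zero) ∙_) (sum-cong-≗ λ j → ≡.cong f (punchIn-punchOut (τ₀≢ j))) ⟨
    f (τ zero) ∙ sum (f ∘ punchIn (τ zero) ∘ τ′)    ≈⟨ ∙-congˡ (sum-reindex-injective τ′ τ′-injective (f ∘ punchIn (τ zero))) ⟩
    f (τ zero) ∙ sum (f ∘ punchIn (τ zero))         ≈⟨ sum-remove f ⟨
    sum f                                           ∎
    where
    open import Data.Fin.Properties using (punchOut-injective; suc-injective)
    τ₀≢ : ∀ j → τ zero ≢ τ (suc j)
    τ₀≢ j eq with inj eq
    ... | ()
    τ′ : Fin n → Fin n
    τ′ j = punchOut (τ₀≢ j)
    τ′-injective : Injectiveᶠ τ′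
    τ′-injective eq = suc-injective (inj (punchOut-injective (τ₀≢ _) (τ₀≢ _) eq))

  ∑ₗ-cong : ∀ {A : Set} (xs : List A) {f g : A → Carrier} → (∀ a → f a ≈ g a) → ∑ₗ xs f ≈ ∑ₗ xs g
  ∑ₗ-cong []       f≈g = refl
  ∑ₗ-cong (x ∷ xs) f≈g = ∙-cong (f≈g x) (∑ₗ-cong xs f≈g)

  ∑ₗ-cong≡ : ∀ {A : Set} (xs : List A) {f g : A → Carrier} → (∀ a → f a ≡ g a) → ∑ₗ xs f ≡ ∑ₗ xs g
  ∑ₗ-cong≡ []       f≡g = ≡.refl
  ∑ₗ-cong≡ (x ∷ xs) f≡g = ≡.cong₂ _∙_ (f≡g x) (∑ₗ-cong≡ xs f≡g)

  ∑ₗ-zero : ∀ {A : Set} (xs : List A) {f : A → Carrier} → (∀ a → f a ≈ ε) → ∑ₗ xs f ≈ ε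
  ∑ₗ-zero []       f≈ε = refl
  ∑ₗ-zero (x ∷ xs) f≈ε = trans (∙-cong (f≈ε x) (∑ₗ-zero xs f≈ε)) (identityˡ ε)

  ∑ₗ-∑-comm : ∀ {A : Set} (xs : List A) {n} (f : A → Vector Carrier n) →
              ∑ₗ xs (λ a → sum (f a)) ≈ sum (λ k → ∑ₗ xs (λ a → f a k))
  ∑ₗ-∑-comm []       {n} f = sym (sum-replicate-zero n)
  ∑ₗ-∑-comm (x ∷ xs)     f = trans (∙-congˡ (∑ₗ-∑-comm xs f)) (sym (∑-distrib-+ (f x) _))

  ∑ₗ-++ : ∀ {A : Set} (xs ys : List A) f → ∑ₗ (xs ++ ys) f ≈ ∑ₗ xs f ∙ ∑ₗ ys f
  ∑ₗ-++ []       ys f = sym (identityˡ _)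
  ∑ₗ-++ (x ∷ xs) ys f = trans (∙-congˡ (∑ₗ-++ xs ys f)) (sym (assoc _ _ _))

  ∑ₗ-map : ∀ {A B : Set} (g : A → B) (xs : List A) f → ∑ₗ (map g xs) f ≡ ∑ₗ xs (f ∘ g)
  ∑ₗ-map g []       f = ≡.refl
  ∑ₗ-map g (x ∷ xs) f = ≡.cong (f (g x) ∙_) (∑ₗ-map g xs f)

  ∑ₗ-concatMap : ∀ {A B : Set} (g : A → List B) (xs : List A) f →
                 ∑ₗ (concatMap g xs) f ≈ ∑ₗ xs (λ a → ∑ₗ (g a) f)
  ∑ₗ-concatMap g []       f = refl
  ∑ₗ-concatMap g (x ∷ xs) f = trans (∑ₗ-++ (g x) (concatMap g xs) f) (∙-congˡ (∑ₗ-concatMap g xs f))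

  ∑ₗ-filter : ∀ {A : Set} {p} {P : Pred A p} (P? : ∀ a → Dec (P a)) (xs : List A) f →
              ∑ₗ (filter P? xs) f ≈ ∑ₗ xs (λ a → when (does (P? a)) (f a))
  ∑ₗ-filter P? []       f = refl
  ∑ₗ-filter P? (x ∷ xs) f with does (P? x)
  ... | true  = ∙-congˡ (∑ₗ-filter P? xs f)
  ... | false = trans (∑ₗ-filter P? xs f) (sym (identityˡ _))

  when-⇔ : ∀ {P Q : Set} → P ⇔ Q → (P? : Dec P) (Q? : Dec Q) (x : Carrier) → when (does P?) x ≡ when (does Q?) x
  when-⇔ P⇔Q P? Q? x = ≡.cong (λ b → when b x) (does-⇔ P⇔Q P? Q?)

  ∑ₗ-filter-⇔ : ∀ {A : Set} {P Q : A → Set} (P? : ∀ a → Dec (P a)) (Q? : ∀ a → Dec (Q a)) → (∀ a → P a ⇔ Q a) →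
                ∀ xs f → ∑ₗ (filter P? xs) f ≈ ∑ₗ xs (λ a → when (does (Q? a)) (f a))
  ∑ₗ-filter-⇔ P? Q? P⇔Q xs f = trans (∑ₗ-filter P? xs f) (∑ₗ-cong xs λ a → reflexive (when-⇔ (P⇔Q a) (P? a) (Q? a) (f a)))

  ∑ₗ-tabulate : ∀ {A : Set} {n} (g : Fin n → A) f → ∑ₗ (tabulate g) f ≡ sum (f ∘ g)
  ∑ₗ-tabulate {n = zero}  g f = ≡.refl
  ∑ₗ-tabulate {n = suc n} g f = ≡.cong (f (g zero) ∙_) (∑ₗ-tabulate (g ∘ suc) f)

  ∑ₗ-allFin : ∀ {n} (f : Vector Carrier n) → ∑ₗ (allFin n) f ≡ sum f
  ∑ₗ-allFin = ∑ₗ-tabulate id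

  when-∧ : ∀ a b x → when (a ∧ b) x ≡ when a (when b x)
  when-∧ true  b x = ≡.refl
  when-∧ false b x = ≡.refl

  when-congᵈ : ∀ {P : Set} (P? : Dec P) {x y} → (P → x ≈ y) → when (does P?) x ≈ when (does P?) y
  when-congᵈ (yes p) x≈y = x≈y p
  when-congᵈ (no _)  x≈y = refl

  when-ε : ∀ b → when b ε ≈ ε
  when-ε true  = refl
  when-ε false = refl

  when-cong : ∀ b {x y} → x ≈ y → when b x ≈ when b y
  when-cong true  x≈y = x≈y
  when-cong false x≈y = refl

module FunctionSums {c ℓ : Level} (M : CommutativeMonoid c ℓ) where
  open CommutativeMonoid M
  open ListSums M
  open import Relation.Binary.Reasoning.Setoid setoid

  -- allFuns builds its functions with its own cons, which agrees with _◂_ only pointwise.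
  Extensional : ∀ {m n} → ((Fin m → Fin n) → Carrier) → Set _
  Extensional T = T Preserves _≗_ ⟶ _≈_

  when-extensional : ∀ {m n} {P : (Fin m → Fin n) → Set} (P? : ∀ f → Dec (P f)) →
                     (∀ {f g} → f ≗ g → P f ⇔ P g) →
                     ∀ {T} → Extensional T → Extensional (λ f → when (does (P? f)) (T f))
  when-extensional P? P-≗ {T} T-ext {f} {g} f≗g
    rewrite does-⇔ (P-≗ f≗g) (P? f) (P? g) = when-cong (does (P? g)) (T-ext f≗g)

  ∑ₗ-allFuns-suc : ∀ {m n} {T : (Fin (suc m) → Fin n) → Carrier} → Extensional T →
                   ∑ₗ (allFuns (suc m) n) T ≈ ∑ₗ (allFuns m n) (λ g → sum (λ v → T (v ◂ g)))
  ∑ₗ-allFuns-suc {m} {n} {T} T-ext = trans (∑ₗ-concatMap _ (allFuns m n) T) (∑ₗ-cong (allFuns m n) λ g →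
    trans (reflexive (≡.trans (∑ₗ-map _ (allFin n) T) (∑ₗ-allFin {n} _)))
          (sum-cong-≋ λ v → T-ext {y = v ◂ g} λ { zero → ≡.refl ; (suc i) → ≡.refl }))

  ∑ₗ-allFuns-insertAt : ∀ {m n} (p : Fin (suc m)) {T : (Fin (suc m) → Fin n) → Carrier} → Extensional T →
                        ∑ₗ (allFuns (suc m) n) T ≈ sum (λ v → ∑ₗ (allFuns m n) (λ g → T (insertAt g p v)))
  ∑ₗ-allFuns-insertAt {m} {n} zero {T} T-ext =
    trans (∑ₗ-allFuns-suc T-ext) (trans (∑ₗ-∑-comm (allFuns m n) (λ g v → T (v ◂ g)))
      (sum-cong-≋ λ v → ∑ₗ-cong (allFuns m n) λ g → T-ext {y = insertAt g zero v} λ { zero → ≡.refl ; (suc i) → ≡.refl }))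
  ∑ₗ-allFuns-insertAt {suc m} {n} (suc p) {T} T-ext = begin
    ∑ₗ (allFuns (suc (suc m)) n) T
      ≈⟨ ∑ₗ-allFuns-suc T-ext ⟩
    ∑ₗ (allFuns (suc m) n) (λ f → sum λ u → T (u ◂ f))
      ≈⟨ ∑ₗ-∑-comm (allFuns (suc m) n) (λ f u → T (u ◂ f)) ⟩
    sum (λ u → ∑ₗ (allFuns (suc m) n) λ f → T (u ◂ f))
      ≈⟨ sum-cong-≋ (λ u → ∑ₗ-allFuns-insertAt p (λ f≗g → T-ext (◂-≗ u f≗g))) ⟩
    sum (λ u → sum λ v → ∑ₗ (allFuns m n) λ g → T (u ◂ insertAt g p v))
      ≈⟨ ∑-comm (λ u v → ∑ₗ (allFuns m n) λ g → T (u ◂ insertAt g p v)) ⟩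
    sum (λ v → sum λ u → ∑ₗ (allFuns m n) λ g → T (u ◂ insertAt g p v))
      ≈⟨ sum-cong-≋ (λ v → sym (∑ₗ-∑-comm (allFuns m n) λ g u → T (u ◂ insertAt g p v))) ⟩
    sum (λ v → ∑ₗ (allFuns m n) λ g → sum λ u → T (u ◂ insertAt g p v))
      ≈⟨ sum-cong-≋ (λ v → ∑ₗ-cong (allFuns m n) λ g → sum-cong-≋ λ u →
           T-ext {y = insertAt (u ◂ g) (suc p) v} λ { zero → ≡.refl ; (suc i) → ≡.refl }) ⟩
    sum (λ v → ∑ₗ (allFuns m n) λ g → sum λ u → T (insertAt (u ◂ g) (suc p) v))
      ≈⟨ sum-cong-≋ (λ v → sym (∑ₗ-allFuns-suc (λ f≗g → T-ext (insertAt-≗ (suc p) v f≗g)))) ⟩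
    sum (λ v → ∑ₗ (allFuns (suc m) n) λ g → T (insertAt g (suc p) v)) ∎

  ∑ₗ-allFuns-avoiding : ∀ {m n} (v : Fin (suc n)) {U : (Fin m → Fin (suc n)) → Carrier} → Extensional U →
                        ∑ₗ (allFuns m (suc n)) (λ g → when (does (avoids? v g)) (U g)) ≈
                        ∑ₗ (allFuns m n) (λ τ → U (punchIn v ∘ τ))
  ∑ₗ-allFuns-avoiding {zero}  v U-ext = ∙-congʳ (U-ext λ ())
  ∑ₗ-allFuns-avoiding {suc m} {n} v {U} U-ext = begin
    ∑ₗ (allFuns (suc m) (suc n)) (λ g → when (does (avoids? v g)) (U g))
      ≈⟨ ∑ₗ-allFuns-suc (when-extensional (avoids? v) (avoids-≗ v) U-ext) ⟩
    ∑ₗ (allFuns m (suc n)) (λ g → sum λ k → when (does (avoids? v (k ◂ g))) (U (k ◂ g)))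
      ≈⟨ ∑ₗ-cong (allFuns m (suc n)) skip-v ⟩
    ∑ₗ (allFuns m (suc n)) (λ g → sum λ k → when (does (avoids? v g)) (U (punchIn v k ◂ g)))
      ≈⟨ ∑ₗ-∑-comm (allFuns m (suc n)) (λ g k → when (does (avoids? v g)) (U (punchIn v k ◂ g))) ⟩
    sum (λ k → ∑ₗ (allFuns m (suc n)) λ g → when (does (avoids? v g)) (U (punchIn v k ◂ g)))
      ≈⟨ sum-cong-≋ (λ k → ∑ₗ-allFuns-avoiding v (λ f≗g → U-ext (◂-≗ (punchIn v k) f≗g))) ⟩
    sum (λ k → ∑ₗ (allFuns m n) λ τ → U (punchIn v k ◂ punchIn v ∘ τ))
      ≈⟨ sum-cong-≋ (λ k → ∑ₗ-cong (allFuns m n) λ τ → U-ext {y = punchIn v ∘ (k ◂ τ)} λ { zero → ≡.refl ; (suc i) → ≡.refl }) ⟩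
    sum (λ k → ∑ₗ (allFuns m n) λ τ → U (punchIn v ∘ (k ◂ τ)))
      ≈⟨ ∑ₗ-∑-comm (allFuns m n) (λ τ k → U (punchIn v ∘ (k ◂ τ))) ⟨
    ∑ₗ (allFuns m n) (λ τ → sum λ k → U (punchIn v ∘ (k ◂ τ)))
      ≈⟨ ∑ₗ-allFuns-suc (λ f≗g → U-ext (≡.cong (punchIn v) ∘ f≗g)) ⟨
    ∑ₗ (allFuns (suc m) n) (λ τ → U (punchIn v ∘ τ)) ∎
    where
    open import Relation.Nullary.Decidable using (dec-false)
    skip-v : ∀ g → sum (λ k → when (does (avoids? v (k ◂ g))) (U (k ◂ g))) ≈
                   sum (λ k → when (does (avoids? v g)) (U (punchIn v k ◂ g)))
    skip-v g = begin
      sum (λ k → when (does (avoids? v (k ◂ g))) (U (k ◂ g)))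
        ≈⟨ sum-remove {i = v} (λ k → when (does (avoids? v (k ◂ g))) (U (k ◂ g))) ⟩
      when (does (avoids? v (v ◂ g))) (U (v ◂ g)) ∙ sum (λ k → when (does (avoids? v (punchIn v k ◂ g))) (U (punchIn v k ◂ g)))
        ≡⟨ ≡.cong₂ (λ b b′ → when b (U (v ◂ g)) ∙ b′) (dec-false (avoids? v (v ◂ g)) (λ av → av zero ≡.refl))
             (sum-cong-≗ λ k → ≡.cong (λ b → when b (U (punchIn v k ◂ g)))
               (does-⇔ (mk⇔ (λ av i → av (suc i)) (λ { av zero → punchInᵢ≢i v k ; av (suc i) → av i }))
                       (avoids? v (punchIn v k ◂ g)) (avoids? v g))) ⟩
      ε ∙ sum (λ k → when (does (avoids? v g)) (U (punchIn v k ◂ g)))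
        ≈⟨ identityˡ _ ⟩
      sum (λ k → when (does (avoids? v g)) (U (punchIn v k ◂ g))) ∎

module PermutationSums {c ℓ : Level} (M : CommutativeMonoid c ℓ) where
  open CommutativeMonoid M
  open ListSums M
  open FunctionSums M
  open import Relation.Binary.Reasoning.Setoid setoid

  ∑ₗ-Sym : ∀ n (T : (Fin n → Fin n) → Carrier) →
           ∑ₗ (Sym n) T ≈ ∑ₗ (allFuns n n) (λ σ → when (does (injective? σ)) (T σ))
  ∑ₗ-Sym n T = ∑ₗ-filter-⇔ _ injective? isPerm⇔injective (allFuns n n) T

  ∑ₗ-Sym-cong : ∀ n {f g : (Fin n → Fin n) → Carrier} → (∀ τ → Injectiveᶠ τ → f τ ≈ g τ) →
                ∑ₗ (Sym n) f ≈ ∑ₗ (Sym n) g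
  ∑ₗ-Sym-cong n {f} {g} f≈g = begin
    ∑ₗ (Sym n) f                                                ≈⟨ ∑ₗ-Sym n f ⟩
    ∑ₗ (allFuns n n) (λ τ → when (does (injective? τ)) (f τ))   ≈⟨ ∑ₗ-cong (allFuns n n) (λ τ → when-congᵈ (injective? τ) (f≈g τ)) ⟩
    ∑ₗ (allFuns n n) (λ τ → when (does (injective? τ)) (g τ))   ≈⟨ ∑ₗ-Sym n g ⟨
    ∑ₗ (Sym n) g                                                ∎

  ∑ₗ-injective-insertAt : ∀ {n} (p v : Fin (suc n)) {U : (Fin (suc n) → Fin (suc n)) → Carrier} → Extensional U →
    ∑ₗ (allFuns n (suc n)) (λ g → when (does (injective? (insertAt g p v))) (U (insertAt g p v))) ≈
    ∑ₗ (Sym n) (λ τ → U (insertAt (punchIn v ∘ τ) p v))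
  ∑ₗ-injective-insertAt {n} p v {U} U-ext = begin
    ∑ₗ (allFuns n (suc n)) (λ g → when (does (injective? (insertAt g p v))) (U (insertAt g p v)))
      ≡⟨ ∑ₗ-cong≡ (allFuns n (suc n)) (λ g →
           ≡.trans (when-⇔ (insertAt-injective g p v) (injective? (insertAt g p v)) (avoids? v g ×-dec injective? g) (U (insertAt g p v)))
                   (when-∧ (does (avoids? v g)) (does (injective? g)) (U (insertAt g p v)))) ⟩
    ∑ₗ (allFuns n (suc n)) (λ g → when (does (avoids? v g)) (when (does (injective? g)) (U (insertAt g p v))))
      ≈⟨ ∑ₗ-allFuns-avoiding v (when-extensional injective? injective-≗ (U-ext ∘ insertAt-≗ p v)) ⟩
    ∑ₗ (allFuns n n) (λ τ → when (does (injective? (punchIn v ∘ τ))) (U (insertAt (punchIn v ∘ τ) p v)))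
      ≡⟨ ∑ₗ-cong≡ (allFuns n n) (λ τ →
           when-⇔ (∘-punchIn-injective v τ) (injective? (punchIn v ∘ τ)) (injective? τ) (U (insertAt (punchIn v ∘ τ) p v))) ⟩
    ∑ₗ (allFuns n n) (λ τ → when (does (injective? τ)) (U (insertAt (punchIn v ∘ τ) p v)))
      ≈⟨ ∑ₗ-Sym n (λ τ → U (insertAt (punchIn v ∘ τ) p v)) ⟨
    ∑ₗ (Sym n) (λ τ → U (insertAt (punchIn v ∘ τ) p v)) ∎

  ∑ₗ-Sym-by-image-of-zero : ∀ n {T : (Fin (suc n) → Fin (suc n)) → Carrier} → Extensional T →
                            ∑ₗ (Sym (suc n)) T ≈ sum (λ k → ∑ₗ (Sym n) (λ τ → T (k ◂ punchIn k ∘ τ)))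
  ∑ₗ-Sym-by-image-of-zero n {T} T-ext = begin
    ∑ₗ (Sym (suc n)) T
      ≈⟨ ∑ₗ-Sym (suc n) T ⟩
    ∑ₗ (allFuns (suc n) (suc n)) (λ σ → when (does (injective? σ)) (T σ))
      ≈⟨ ∑ₗ-allFuns-insertAt zero (when-extensional injective? injective-≗ T-ext) ⟩
    sum (λ k → ∑ₗ (allFuns n (suc n)) λ g → when (does (injective? (insertAt g zero k))) (T (insertAt g zero k)))
      ≈⟨ sum-cong-≋ (λ k → ∑ₗ-injective-insertAt zero k T-ext) ⟩
    sum (λ k → ∑ₗ (Sym n) (λ τ → T (insertAt (punchIn k ∘ τ) zero k)))
      ≈⟨ sum-cong-≋ (λ k → ∑ₗ-cong (Sym n) λ τ →
           T-ext {x = insertAt (punchIn k ∘ τ) zero k} {y = k ◂ punchIn k ∘ τ} λ { zero → ≡.refl ; (suc i) → ≡.refl }) ⟩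
    sum (λ k → ∑ₗ (Sym n) (λ τ → T (k ◂ punchIn k ∘ τ))) ∎

  when-injective≈∑-preimage-of-zero :
    ∀ {n} (σ : Fin (suc n) → Fin (suc n)) (x : Carrier) →
    when (does (injective? σ)) x ≈ sum (λ k → when (does (σ k ≟ zero)) (when (does (injective? σ)) x))
  when-injective≈∑-preimage-of-zero σ x = split (injective? σ)
    where
    open import Relation.Nullary.Decidable using (dec-true; dec-false)
    split : (inj? : Dec (Injectiveᶠ σ)) → when (does inj?) x ≈ sum (λ k → when (does (σ k ≟ zero)) (when (does inj?) x))
    split (no _)    = sym (sum-zero λ k → when-ε (does (σ k ≟ zero)))
    split (yes inj) = sym (trans
      (sum-single k₀ (λ k → when (does (σ k ≟ zero)) x)
        λ j → reflexive (≡.cong (λ b → when b x) (dec-false (σ (punchIn k₀ j) ≟ zero) (missed j))))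
      (reflexive (≡.cong (λ b → when b x) (dec-true (σ k₀ ≟ zero) σk₀≡0))))
      where
      k₀ = proj₁ (injective⇒hits-zero σ inj)
      σk₀≡0 = proj₂ (injective⇒hits-zero σ inj)
      missed : ∀ j → σ (punchIn k₀ j) ≢ zero
      missed j σj≡0 = punchInᵢ≢i k₀ j (inj (≡.trans σj≡0 (≡.sym σk₀≡0)))

  ∑ₗ-Sym-by-preimage-of-zero : ∀ n {T : (Fin (suc n) → Fin (suc n)) → Carrier} → Extensional T →
                               ∑ₗ (Sym (suc n)) T ≈ sum (λ k → ∑ₗ (Sym n) (λ τ → T (insertAt (suc ∘ τ) k zero)))
  ∑ₗ-Sym-by-preimage-of-zero n {T} T-ext = begin
    ∑ₗ (Sym (suc n)) T
      ≈⟨ ∑ₗ-Sym (suc n) T ⟩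
    ∑ₗ (allFuns (suc n) (suc n)) (λ σ → when (does (injective? σ)) (T σ))
      ≈⟨ ∑ₗ-cong (allFuns (suc n) (suc n)) (λ σ → when-injective≈∑-preimage-of-zero σ (T σ)) ⟩
    ∑ₗ (allFuns (suc n) (suc n)) (λ σ → sum λ k → when (does (σ k ≟ zero)) (when (does (injective? σ)) (T σ)))
      ≈⟨ ∑ₗ-∑-comm (allFuns (suc n) (suc n)) (λ σ k → when (does (σ k ≟ zero)) (when (does (injective? σ)) (T σ))) ⟩
    sum (λ k → ∑ₗ (allFuns (suc n) (suc n)) λ σ → when (does (σ k ≟ zero)) (when (does (injective? σ)) (T σ)))
      ≈⟨ sum-cong-≋ (λ k → ∑ₗ-allFuns-insertAt k (when-extensional (λ σ → σ k ≟ zero) (λ f≗g → at-k-≗ k f≗g)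
                                                   (when-extensional injective? injective-≗ T-ext))) ⟩
    sum (λ k → sum λ v → ∑ₗ (allFuns n (suc n)) λ g →
      when (does (insertAt g k v k ≟ zero)) (when (does (injective? (insertAt g k v))) (T (insertAt g k v))))
      ≡⟨ sum-cong-≗ (λ k → sum-cong-≗ λ v → ∑ₗ-cong≡ (allFuns n (suc n)) λ g →
           ≡.cong (λ w → when (does (w ≟ zero)) (when (does (injective? (insertAt g k v))) (T (insertAt g k v)))) (insertAt-lookup g k v)) ⟩
    sum (λ k → sum λ v → ∑ₗ (allFuns n (suc n)) λ g →
      when (does (v ≟ zero)) (when (does (injective? (insertAt g k v))) (T (insertAt g k v))))
      ≈⟨ sum-cong-≋ (λ k → sum-single zero (λ v → ∑ₗ (allFuns n (suc n)) λ g →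
           when (does (v ≟ zero)) (when (does (injective? (insertAt g k v))) (T (insertAt g k v))))
           (λ v → ∑ₗ-zero (allFuns n (suc n)) λ g → refl)) ⟩
    sum (λ k → ∑ₗ (allFuns n (suc n)) λ g → when (does (injective? (insertAt g k zero))) (T (insertAt g k zero)))
      ≈⟨ sum-cong-≋ (λ k → ∑ₗ-injective-insertAt k zero T-ext) ⟩
    sum (λ k → ∑ₗ (Sym n) (λ τ → T (insertAt (suc ∘ τ) k zero))) ∎
    where
    at-k-≗ : ∀ k {f g : Fin (suc n) → Fin (suc n)} → f ≗ g → (f k ≡ zero) ⇔ (g k ≡ zero)
    at-k-≗ k f≗g = mk⇔ (≡.trans (≡.sym (f≗g k))) (≡.trans (f≗g k))

module Inversions where
  open ListSums ℕ.+-0-commutativeMonoid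
  open ≡ using (refl; sym; trans; cong; cong₂; module ≡-Reasoning)

  Inverted : ∀ {n} → (Fin n → Fin n) → Fin n → Fin n → Set
  Inverted σ i j = i < j × σ j < σ i

  inverted? : ∀ {n} (σ : Fin n → Fin n) i j → Dec (Inverted σ i j)
  inverted? σ i j = i <? j ×-dec σ j <? σ i

  T-⌊⌋∧⌊⌋ : ∀ {A B : Set} (a? : Dec A) (b? : Dec B) → T (⌊ a? ⌋ ∧ ⌊ b? ⌋) ⇔ (A × B)
  T-⌊⌋∧⌊⌋ a? b? = mk⇔
    (λ t → let ta , tb = Equivalence.to (T-∧ {⌊ a? ⌋}) t in toWitness {a? = a?} ta , toWitness {a? = b?} tb)
    (λ (a , b) → Equivalence.from (T-∧ {⌊ a? ⌋}) (fromWitness {a? = a?} a , fromWitness {a? = b?} b))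

  inversions≡∑ : ∀ {n} (σ : Fin n → Fin n) → inversions σ ≡ sum (λ i → sum λ j → when (does (inverted? σ i j)) 1)
  inversions≡∑ {n} σ = begin
    length (filter _ pairs)                                              ≡⟨⟩
    ∑ₗ (filter _ pairs) (λ _ → 1)
      ≡⟨ ∑ₗ-filter-⇔ _ (λ (i , j) → inverted? σ i j) (λ (i , j) → T-⌊⌋∧⌊⌋ (i <? j) (σ j <? σ i)) pairs (λ _ → 1) ⟩
    ∑ₗ pairs (λ (i , j) → when (does (inverted? σ i j)) 1)              ≡⟨ ∑ₗ-concatMap (λ i → map (i ,_) (allFin n)) (allFin n) _ ⟩
    ∑ₗ (allFin n) (λ i → ∑ₗ (map (i ,_) (allFin n)) λ (i , j) → when (does (inverted? σ i j)) 1)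
      ≡⟨ ∑ₗ-cong≡ (allFin n) (λ i → trans (∑ₗ-map (i ,_) (allFin n) _) (∑ₗ-allFin λ j → when (does (inverted? σ i j)) 1)) ⟩
    ∑ₗ (allFin n) (λ i → sum λ j → when (does (inverted? σ i j)) 1)     ≡⟨ ∑ₗ-allFin (λ i → sum λ j → when (does (inverted? σ i j)) 1) ⟩
    sum (λ i → sum λ j → when (does (inverted? σ i j)) 1)               ∎
    where
    open ≡-Reasoning
    pairs : List (Fin n × Fin n)
    pairs = concatMap (λ i → map (i ,_) (allFin n)) (allFin n)

  inversions-≗ : ∀ {n} {σ σ′ : Fin n → Fin n} → σ ≗ σ′ → inversions σ ≡ inversions σ′
  inversions-≗ {σ = σ} {σ′} σ≗σ′ = trans (inversions≡∑ σ) (trans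
    (sum-cong-≗ λ i → sum-cong-≗ λ j → cong₂ (λ u v → when (does (i <? j) ∧ does (u <? v)) 1) (σ≗σ′ j) (σ≗σ′ i))
    (sym (inversions≡∑ σ′)))

  punchIn-<?-punchIn : ∀ {n} (k : Fin (suc n)) (a b : Fin n) → does (punchIn k a <? punchIn k b) ≡ does (a <? b)
  punchIn-<?-punchIn zero    a       b       = refl
  punchIn-<?-punchIn (suc k) zero    zero    = refl
  punchIn-<?-punchIn (suc k) zero    (suc b) = refl
  punchIn-<?-punchIn (suc k) (suc a) zero    = refl
  punchIn-<?-punchIn (suc k) (suc a) (suc b) = punchIn-<?-punchIn k a b

  punchIn-<?-pivot : ∀ {n} (k : Fin (suc n)) (i : Fin n) → does (punchIn k i <? k) ≡ does (i <? k)
  punchIn-<?-pivot zero    i       = refl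
  punchIn-<?-pivot (suc k) zero    = refl
  punchIn-<?-pivot (suc k) (suc i) = punchIn-<?-pivot k i

  count-< : ∀ {n} (k : Fin (suc n)) → sum (λ (l : Fin n) → when (does (l <? k)) 1) ≡ toℕ k
  count-< {zero}  zero    = refl
  count-< {suc n} zero    = count-< {n} zero
  count-< {suc n} (suc k) = cong suc (count-< k)

  inversions-◂-punchIn : ∀ {n} (k : Fin (suc n)) (τ : Fin n → Fin n) → Injectiveᶠ τ →
                         inversions (k ◂ punchIn k ∘ τ) ≡ toℕ k ℕ.+ inversions τ
  inversions-◂-punchIn {n} k τ inj = begin
    inversions σ
      ≡⟨ inversions≡∑ σ ⟩
    sum (λ j → when (does (σ (suc j) <? k)) 1) ℕ.+ sum (λ i → sum λ j → when (does (inverted? σ (suc i) (suc j))) 1)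
      ≡⟨ cong₂ ℕ._+_ (sum-cong-≗ λ j → cong (λ b → when b 1) (punchIn-<?-pivot k (τ j)))
                     (sum-cong-≗ λ i → sum-cong-≗ λ j → cong (λ b → when (does (i <? j) ∧ b) 1) (punchIn-<?-punchIn k (τ j) (τ i))) ⟩
    sum (λ j → when (does (τ j <? k)) 1) ℕ.+ sum (λ i → sum λ j → when (does (inverted? τ i j)) 1)
      ≡⟨ cong₂ ℕ._+_ (trans (sum-reindex-injective τ inj (λ l → when (does (l <? k)) 1)) (count-< k)) (sym (inversions≡∑ τ)) ⟩
    toℕ k ℕ.+ inversions τ ∎
    where
    open ≡-Reasoning
    σ = k ◂ punchIn k ∘ τ

  inversions-insertAt-zero : ∀ {n} (k : Fin (suc n)) (τ : Fin n → Fin n) →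
                             inversions (insertAt (suc ∘ τ) k zero) ≡ toℕ k ℕ.+ inversions τ
  inversions-insertAt-zero {n} k τ = begin
    inversions σ
      ≡⟨ inversions≡∑ σ ⟩
    sum (λ i → row i)
      ≡⟨ sum-remove {i = k} row ⟩
    row k ℕ.+ sum (λ i → row (punchIn k i))
      ≡⟨ cong₂ ℕ._+_ row-k (sum-cong-≗ row-punchIn) ⟩
    0 ℕ.+ sum (λ (i : Fin n) → when (does (i <? k)) 1 ℕ.+ sum (λ j → when (does (inverted? τ i j)) 1))
      ≡⟨ ∑-distrib-+ (λ (i : Fin n) → when (does (i <? k)) 1) (λ i → sum λ j → when (does (inverted? τ i j)) 1) ⟩
    sum (λ (i : Fin n) → when (does (i <? k)) 1) ℕ.+ sum (λ i → sum λ j → when (does (inverted? τ i j)) 1)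
      ≡⟨ cong₂ ℕ._+_ (count-< k) (sym (inversions≡∑ τ)) ⟩
    toℕ k ℕ.+ inversions τ ∎
    where
    open ≡-Reasoning
    σ = insertAt (suc ∘ τ) k zero
    row : Fin (suc n) → ℕ
    row i = sum λ j → when (does (inverted? σ i j)) 1
    σk≡0 : σ k ≡ zero
    σk≡0 = insertAt-lookup (suc ∘ τ) k zero
    σ-punchIn : ∀ i → σ (punchIn k i) ≡ suc (τ i)
    σ-punchIn = insertAt-punchIn (suc ∘ τ) k zero
    row-k : row k ≡ 0
    row-k = trans (sum-cong-≗ λ j → cong (λ v → when (does (k <? j) ∧ does (σ j <? v)) 1) σk≡0)
                  (sum-zero {f = λ (j : Fin (suc n)) → when (does (k <? j) ∧ does (σ j <? zero {n})) 1} λ j → cong (λ b → when b 1) (∧-zeroʳ (does (k <? j))))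
    row-punchIn : ∀ i → row (punchIn k i) ≡ when (does (i <? k)) 1 ℕ.+ sum (λ j → when (does (inverted? τ i j)) 1)
    row-punchIn i = begin
      row (punchIn k i)
        ≡⟨ sum-remove {i = k} (λ j → when (does (inverted? σ (punchIn k i) j)) 1) ⟩
      when (does (inverted? σ (punchIn k i) k)) 1 ℕ.+ sum (λ j → when (does (inverted? σ (punchIn k i) (punchIn k j))) 1)
        ≡⟨ cong₂ ℕ._+_ (cong (λ b → when b 1) at-k) (sum-cong-≗ λ j → cong (λ b → when b 1) (at-punchIn j)) ⟩
      when (does (i <? k)) 1 ℕ.+ sum (λ j → when (does (inverted? τ i j)) 1) ∎
      where
      at-k : does (inverted? σ (punchIn k i) k) ≡ does (i <? k)
      at-k = begin
        does (punchIn k i <? k) ∧ does (σ k <? σ (punchIn k i)) ≡⟨ cong₂ (λ u v → does (punchIn k i <? k) ∧ does (u <? v)) σk≡0 (σ-punchIn i) ⟩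
        does (punchIn k i <? k) ∧ true                           ≡⟨ ∧-identityʳ _ ⟩
        does (punchIn k i <? k)                                  ≡⟨ punchIn-<?-pivot k i ⟩
        does (i <? k)                                            ∎
      at-punchIn : ∀ j → does (inverted? σ (punchIn k i) (punchIn k j)) ≡ does (inverted? τ i j)
      at-punchIn j = cong₂ (λ b u → b ∧ does (u <? σ (punchIn k i))) (punchIn-<?-punchIn k i j) (σ-punchIn j)
                     ⟨ trans ⟩ cong (λ v → does (i <? j) ∧ does (suc (τ j) <? v)) (σ-punchIn i)

open Inversions

module Signs {c ℓ : Level} (R : CommutativeRing c ℓ) where
  open CommutativeRing R hiding (zero)
  open RingDefs R
  open import Algebra.Properties.Ring ring using (-1*x≈-x; -‿involutive)
  open import Relation.Binary.Reasoning.Setoid setoid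
  open import Data.Nat.Base using (_%_)

  pow-+ : ∀ x m n → pow x (m ℕ.+ n) ≈ pow x m * pow x n
  pow-+ x zero    n = sym (*-identityˡ _)
  pow-+ x (suc m) n = trans (*-congˡ (pow-+ x m n)) (sym (*-assoc _ _ _))

  parity≈pow-1 : ∀ m → (if ⌊ m % 2 ℕ.≟ 0 ⌋ then 1# else - 1#) ≈ pow (- 1#) m
  parity≈pow-1 zero          = refl
  parity≈pow-1 (suc zero)    = sym (*-identityʳ _)
  parity≈pow-1 (suc (suc m)) = begin
    (if ⌊ m % 2 ℕ.≟ 0 ⌋ then 1# else - 1#)  ≈⟨ parity≈pow-1 m ⟩
    pow (- 1#) m                            ≈⟨ -‿involutive _ ⟨
    - - pow (- 1#) m                        ≈⟨ -‿cong (-1*x≈-x _) ⟨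
    - (- 1# * pow (- 1#) m)                 ≈⟨ -1*x≈-x _ ⟨
    - 1# * (- 1# * pow (- 1#) m)            ∎

  sgn≈pow-1 : ∀ {n} (σ : Fin n → Fin n) → sgn σ ≈ pow (- 1#) (inversions σ)
  sgn≈pow-1 σ = parity≈pow-1 (inversions σ)

  sgn-≗ : ∀ {n} {σ σ′ : Fin n → Fin n} → σ ≗ σ′ → sgn σ ≡ sgn σ′
  sgn-≗ σ≗σ′ = ≡.cong (λ m → if ⌊ m % 2 ℕ.≟ 0 ⌋ then 1# else - 1#) (inversions-≗ σ≗σ′)

  sgn-shift : ∀ {n m} (σ : Fin (suc n) → Fin (suc n)) (τ : Fin n → Fin n) (k : Fin m) →
              inversions σ ≡ toℕ k ℕ.+ inversions τ → sgn σ ≈ pow (- 1#) (toℕ k) * sgn τ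
  sgn-shift σ τ k inv≡ = begin
    sgn σ                                          ≈⟨ sgn≈pow-1 σ ⟩
    pow (- 1#) (inversions σ)                      ≡⟨ ≡.cong (pow (- 1#)) inv≡ ⟩
    pow (- 1#) (toℕ k ℕ.+ inversions τ)            ≈⟨ pow-+ (- 1#) (toℕ k) (inversions τ) ⟩
    pow (- 1#) (toℕ k) * pow (- 1#) (inversions τ) ≈⟨ *-congˡ (sgn≈pow-1 τ) ⟨
    pow (- 1#) (toℕ k) * sgn τ                     ∎

  sgn-◂-punchIn : ∀ {n} (k : Fin (suc n)) (τ : Fin n → Fin n) → Injectiveᶠ τ →
                  sgn (k ◂ punchIn k ∘ τ) ≈ pow (- 1#) (toℕ k) * sgn τ
  sgn-◂-punchIn k τ inj = sgn-shift _ τ k (inversions-◂-punchIn k τ inj)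

  sgn-insertAt-zero : ∀ {n} (k : Fin (suc n)) (τ : Fin n → Fin n) →
                      sgn (insertAt (suc ∘ τ) k zero) ≈ pow (- 1#) (toℕ k) * sgn τ
  sgn-insertAt-zero k τ = sgn-shift _ τ k (inversions-insertAt-zero k τ)

  open ListSums +-commutativeMonoid using (sum; sum-cong-≋)
  open FunctionSums +-commutativeMonoid using (Extensional)
  open PermutationSums +-commutativeMonoid
    using (∑ₗ-Sym-cong; ∑ₗ-Sym-by-image-of-zero; ∑ₗ-Sym-by-preimage-of-zero)

  *-distribˡ-Σ-list : ∀ {A : Set} x (xs : List A) f → x * Σ-list xs f ≈ Σ-list xs (λ a → x * f a)
  *-distribˡ-Σ-list x []       f = zeroʳ x
  *-distribˡ-Σ-list x (a ∷ xs) f = trans (distribˡ x (f a) _) (+-congˡ (*-distribˡ-Σ-list x xs f))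

  private
    signed : ∀ {n} → (T : (Fin n → Fin n) → Carrier) → Extensional T → Extensional (λ σ → sgn σ * T σ)
    signed T T-ext σ≗σ′ = *-cong (reflexive (sgn-≗ σ≗σ′)) (T-ext σ≗σ′)

    factor-sign : ∀ {n m} (k : Fin m) (ρ : (Fin n → Fin n) → Fin (suc n) → Fin (suc n)) (T : (Fin (suc n) → Fin (suc n)) → Carrier) →
                  (∀ τ → Injectiveᶠ τ → sgn (ρ τ) ≈ pow (- 1#) (toℕ k) * sgn τ) →
                  Σ-list (Sym n) (λ τ → sgn (ρ τ) * T (ρ τ)) ≈ pow (- 1#) (toℕ k) * Σ-list (Sym n) (λ τ → sgn τ * T (ρ τ))
    factor-sign {n} k ρ T sgn-ρ = trans
      (∑ₗ-Sym-cong n λ τ inj → trans (*-congʳ (sgn-ρ τ inj)) (*-assoc _ _ _))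
      (sym (*-distribˡ-Σ-list _ (Sym n) _))

  Σ-Sym-by-image-of-zero : ∀ n {T : (Fin (suc n) → Fin (suc n)) → Carrier} → Extensional T →
    Σ-list (Sym (suc n)) (λ σ → sgn σ * T σ) ≈
    sum (λ k → pow (- 1#) (toℕ k) * Σ-list (Sym n) (λ τ → sgn τ * T (k ◂ punchIn k ∘ τ)))
  Σ-Sym-by-image-of-zero n {T} T-ext = trans (∑ₗ-Sym-by-image-of-zero n (signed T T-ext))
    (sum-cong-≋ λ k → factor-sign k (λ τ → k ◂ punchIn k ∘ τ) T (sgn-◂-punchIn k))

  Σ-Sym-by-preimage-of-zero : ∀ n {T : (Fin (suc n) → Fin (suc n)) → Carrier} → Extensional T →
    Σ-list (Sym (suc n)) (λ σ → sgn σ * T σ) ≈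
    sum (λ k → pow (- 1#) (toℕ k) * Σ-list (Sym n) (λ τ → sgn τ * T (insertAt (suc ∘ τ) k zero)))
  Σ-Sym-by-preimage-of-zero n {T} T-ext = trans (∑ₗ-Sym-by-preimage-of-zero n (signed T T-ext))
    (sum-cong-≋ λ k → factor-sign k (λ τ → insertAt (suc ∘ τ) k zero) T (λ τ _ → sgn-insertAt-zero k τ))

module Laplace {c ℓ : Level} (R : CommutativeRing c ℓ) where
  open CommutativeRing R hiding (zero)
  open RingDefs R
  open import Algebra.Properties.Ring ring using (-1*x≈-x; -‿distribˡ-*; -0#≈0#; -‿+-comm)
  open import Algebra.Properties.Semiring.Sum semiring using (*-distribˡ-sum)
  open ListSums +-commutativeMonoid using (sum; sum-cong-≋; sum-zero; ∑-distrib-+)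
  open IntegerCoefficientSolver R using (solve; _:+_; _:*_; :-_; _:-_; _:=_)
  open import Relation.Binary.Reasoning.Setoid setoid

  -- The matrix (C j (X i) (Y i)) is given by its columns C j, functions of the two indeterminates of a row.
  Column : Set c
  Column = Carrier → Carrier → Carrier

  Form : ℕ → Set c
  Form m = Vector Carrier m → Vector Carrier m → Carrier

  Extensional₂ : ∀ {m} → Form m → Set (c ⊔ ℓ)
  Extensional₂ W = W Preserves₂ _≗_ ⟶ _≗_ ⟶ _≈_

  -- Opaque, so that unification sees expand rather than an unfolded sum over Fin (suc m).
  opaque
    expand : ∀ {m} → Column → Form m → Form (suc m)
    expand b W X Y = sum λ k → pow (- 1#) (toℕ k) * (b (X k) (Y k) * W (removeAt X k) (removeAt Y k))

  laplace : ∀ m → Vector Column m → Form m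
  laplace zero    C X Y = 1#
  laplace (suc m) C     = expand (head C) (laplace m (tail C))

  sum-neg : ∀ {n} (f : Vector Carrier n) → sum (λ i → - f i) ≈ - sum f
  sum-neg {zero}  f = sym -0#≈0#
  sum-neg {suc n} f = trans (+-congˡ (sum-neg (tail f))) (-‿+-comm _ _)

  opaque
    unfolding expand
    expand-sum : ∀ {m} b (W : Form m) X Y →
                 expand b W X Y ≡ sum (λ k → pow (- 1#) (toℕ k) * (b (X k) (Y k) * W (removeAt X k) (removeAt Y k)))
    expand-sum b W X Y = ≡.refl

    expand-cong : ∀ {m} {b b′ : Column} {W W′ : Form m} {X Y X′ Y′ : Vector Carrier (suc m)} →
                  (∀ k → b (X k) (Y k) ≈ b′ (X′ k) (Y′ k)) →
                  (∀ k → W (removeAt X k) (removeAt Y k) ≈ W′ (removeAt X′ k) (removeAt Y′ k)) →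
                  expand b W X Y ≈ expand b′ W′ X′ Y′
    expand-cong {b = b} {b′} {W} {W′} {X} {Y} {X′} {Y′} b≈b′ W≈W′ =
      sum-cong-≋ {x = λ k → pow (- 1#) (toℕ k) * (b (X k) (Y k) * W (removeAt X k) (removeAt Y k))}
                 {y = λ k → pow (- 1#) (toℕ k) * (b′ (X′ k) (Y′ k) * W′ (removeAt X′ k) (removeAt Y′ k))}
                 (λ k → *-congˡ (*-cong (b≈b′ k) (W≈W′ k)))

    expand-linear : ∀ {m} (W : Form m) X Y a (b b₁ b₂ : Column) →
                    (∀ k → b (X k) (Y k) ≈ a * b₁ (X k) (Y k) + b₂ (X k) (Y k)) →
                    expand b W X Y ≈ a * expand b₁ W X Y + expand b₂ W X Y
    expand-linear {m} W X Y a b b₁ b₂ b≈ = begin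
      sum (λ k → s k * (b (X k) (Y k) * w k))
        ≈⟨ sum-cong-≋ (λ k → trans (*-congˡ (*-congʳ (b≈ k)))
             (solve 5 (λ s a c₁ c₂ w → s :* ((a :* c₁ :+ c₂) :* w) := a :* (s :* (c₁ :* w)) :+ s :* (c₂ :* w)) refl
               (s k) a (b₁ (X k) (Y k)) (b₂ (X k) (Y k)) (w k))) ⟩
      sum (λ k → a * (s k * (b₁ (X k) (Y k) * w k)) + s k * (b₂ (X k) (Y k) * w k))
        ≈⟨ ∑-distrib-+ (λ k → a * (s k * (b₁ (X k) (Y k) * w k))) (λ k → s k * (b₂ (X k) (Y k) * w k)) ⟩
      sum (λ k → a * (s k * (b₁ (X k) (Y k) * w k))) + expand b₂ W X Y
        ≈⟨ +-congʳ (*-distribˡ-sum a (λ k → s k * (b₁ (X k) (Y k) * w k))) ⟨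
      a * expand b₁ W X Y + expand b₂ W X Y ∎
      where
      s : Fin (suc m) → Carrier
      s k = pow (- 1#) (toℕ k)
      w : Fin (suc m) → Carrier
      w k = W (removeAt X k) (removeAt Y k)

    expand-zero-column : ∀ {m} b (W : Form m) X Y → (∀ k → b (X k) (Y k) ≈ 0#) → expand b W X Y ≈ 0#
    expand-zero-column b W X Y b≈0 = sum-zero {f = λ k → pow (- 1#) (toℕ k) * (b (X k) (Y k) * W (removeAt X k) (removeAt Y k))} λ k →
      trans (*-congˡ (trans (*-congʳ (b≈0 k)) (zeroˡ _))) (zeroʳ _)

    expand-zero-form : ∀ {m} b (W : Form m) X Y → (∀ U V → W U V ≈ 0#) → expand b W X Y ≈ 0#
    expand-zero-form b W X Y W≈0 = sum-zero {f = λ k → pow (- 1#) (toℕ k) * (b (X k) (Y k) * W (removeAt X k) (removeAt Y k))} λ k →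
      trans (*-congˡ (trans (*-congˡ (W≈0 (removeAt X k) (removeAt Y k))) (zeroʳ _))) (zeroʳ _)

    expand-scale : ∀ {m} b (W : Form m) a X Y → expand b (λ U V → a * W U V) X Y ≈ a * expand b W X Y
    expand-scale b W a X Y = trans
      (sum-cong-≋ λ k → solve 4 (λ s c a w → s :* (c :* (a :* w)) := a :* (s :* (c :* w))) refl
                          (pow (- 1#) (toℕ k)) (b (X k) (Y k)) a (W (removeAt X k) (removeAt Y k)))
      (sym (*-distribˡ-sum a λ k → pow (- 1#) (toℕ k) * (b (X k) (Y k) * W (removeAt X k) (removeAt Y k))))

  expand-extensional : ∀ {m} b {W : Form m} → Extensional₂ W → Extensional₂ (expand b W)
  expand-extensional b W-ext X≗X′ Y≗Y′ =
    expand-cong (λ k → reflexive (≡.cong₂ b (X≗X′ k) (Y≗Y′ k))) (λ k → W-ext (X≗X′ ∘ punchIn k) (Y≗Y′ ∘ punchIn k))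

  laplace-extensional : ∀ m (C : Vector Column m) → Extensional₂ (laplace m C)
  laplace-extensional zero    C _ _ = refl
  laplace-extensional (suc m) C     = expand-extensional (head C) (laplace-extensional m (tail C))

  laplace-cong : ∀ m (C C′ : Vector Column m) → (∀ j x y → C j x y ≈ C′ j x y) → ∀ X Y → laplace m C X Y ≈ laplace m C′ X Y
  laplace-cong zero    C C′ C≈C′ X Y = refl
  laplace-cong (suc m) C C′ C≈C′ X Y =
    expand-cong (λ k → C≈C′ zero (X k) (Y k)) (λ k → laplace-cong m (tail C) (tail C′) (C≈C′ ∘ suc) (removeAt X k) (removeAt Y k))

  pinHead : ∀ {m} → Form (suc m) → Carrier → Carrier → Form m
  pinHead W x y U V = W (x ◂ U) (y ◂ V)

  headTerm : ∀ {m} → Column → Column → Form m → Form (suc (suc m))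
  headTerm a b W X Y = a (X zero) (Y zero) * expand b W (tail X) (tail Y)

  -- The terms of expand a (expand b W) in which column a uses a row above the one used by column b.
  ordered : ∀ m → Column → Column → Form m → Form (suc (suc m))
  ordered zero    a b W X Y = headTerm a b W X Y
  ordered (suc m) a b W X Y = headTerm a b W X Y + ordered m a b (pinHead W (X zero) (Y zero)) (tail X) (tail Y)

  private
    lowerTerms : ∀ {m} → Column → Column → Form m → Form (suc (suc m))
    lowerTerms a b W X Y = sum λ k → pow (- 1#) (toℕ k) * (a (X (suc k)) (Y (suc k)) *
      sum λ l → pow (- 1#) (toℕ l) * (b (X (suc (punchIn k l))) (Y (suc (punchIn k l))) *
        W (removeAt (removeAt X (suc k)) (suc l)) (removeAt (removeAt Y (suc k)) (suc l))))

  opaque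
    unfolding expand

    expand-twice-split : ∀ {m} a b (W : Form m) X Y →
      expand a (expand b W) X Y ≈ headTerm a b W X Y + (- headTerm b a W X Y + lowerTerms a b W X Y)
    expand-twice-split {m} a b W X Y = begin
      1# * (a (X zero) (Y zero) * expand b W (tail X) (tail Y)) + sum (λ k → pow (- 1#) (toℕ (suc k)) *
        (a (X (suc k)) (Y (suc k)) * expand b W (removeAt X (suc k)) (removeAt Y (suc k))))
        ≈⟨ +-cong (*-identityˡ _) (sum-cong-≋ regroup) ⟩
      headTerm a b W X Y + sum (λ k → - first k + rest k)
        ≈⟨ +-congˡ (∑-distrib-+ (λ k → - first k) rest) ⟩
      headTerm a b W X Y + (sum (λ k → - first k) + sum rest)
        ≈⟨ +-congˡ (+-congʳ (trans (sum-neg first) (-‿cong (sum-first)))) ⟩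
      headTerm a b W X Y + (- headTerm b a W X Y + lowerTerms a b W X Y) ∎
      where
      s : ∀ {n} → Fin n → Carrier
      s k = pow (- 1#) (toℕ k)
      w : Fin (suc m) → Carrier
      w k = W (removeAt (tail X) k) (removeAt (tail Y) k)
      first : Fin (suc m) → Carrier
      first k = s k * (b (X zero) (Y zero) * (a (X (suc k)) (Y (suc k)) * w k))
      term : Fin (suc m) → Fin m → Carrier
      term k l = b (X (suc (punchIn k l))) (Y (suc (punchIn k l))) *
                 W (removeAt (removeAt X (suc k)) (suc l)) (removeAt (removeAt Y (suc k)) (suc l))
      inner : Fin (suc m) → Carrier
      inner k = sum λ l → s l * term k l
      rest : Fin (suc m) → Carrier
      rest k = s k * (a (X (suc k)) (Y (suc k)) * inner k)
      inner-shift : ∀ k → sum (λ l → s (suc l) * term k l) ≈ - inner k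
      inner-shift k = begin
        sum (λ l → s (suc l) * term k l)  ≈⟨ sum-cong-≋ (λ l → trans (*-congʳ (-1*x≈-x (s l))) (sym (-‿distribˡ-* (s l) (term k l)))) ⟩
        sum (λ l → - (s l * term k l))    ≈⟨ sum-neg (λ l → s l * term k l) ⟩
        - inner k                         ∎
      regroup : ∀ k → s (suc k) * (a (X (suc k)) (Y (suc k)) * expand b W (removeAt X (suc k)) (removeAt Y (suc k))) ≈ - first k + rest k
      regroup k = trans (*-cong (-1*x≈-x (s k)) (*-congˡ (+-cong (*-identityˡ _) (inner-shift k))))
        (solve 5 (λ sk ak b₀ wk i → (:- sk) :* (ak :* (b₀ :* wk :+ :- i)) := :- (sk :* (b₀ :* (ak :* wk))) :+ sk :* (ak :* i)) refl
          (s k) (a (X (suc k)) (Y (suc k))) (b (X zero) (Y zero)) (w k) (inner k))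
      sum-first : sum first ≈ headTerm b a W X Y
      sum-first = begin
        sum first
          ≈⟨ sum-cong-≋ (λ k → solve 4 (λ sk b₀ ak wk → sk :* (b₀ :* (ak :* wk)) := b₀ :* (sk :* (ak :* wk))) refl
               (s k) (b (X zero) (Y zero)) (a (X (suc k)) (Y (suc k))) (w k)) ⟩
        sum (λ k → b (X zero) (Y zero) * (s k * (a (X (suc k)) (Y (suc k)) * w k)))
          ≈⟨ *-distribˡ-sum (b (X zero) (Y zero)) (λ k → s k * (a (X (suc k)) (Y (suc k)) * w k)) ⟨
        headTerm b a W X Y ∎

    lowerTerms-pinHead : ∀ {m} a b {W : Form (suc m)} → Extensional₂ W → ∀ X Y →
      lowerTerms a b W X Y ≈ expand a (expand b (pinHead W (X zero) (Y zero))) (tail X) (tail Y)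
    lowerTerms-pinHead {m} a b {W} W-ext X Y =
      sum-cong-≋ {x = λ k → s k * (a (X (suc k)) (Y (suc k)) * sum (term k))}
                 {y = λ k → s k * (a (X (suc k)) (Y (suc k)) * sum (term′ k))}
                 (λ k → *-congˡ (*-congˡ (sum-cong-≋ {x = term k} {y = term′ k} λ l → *-congˡ (*-congˡ
                   (W-ext (λ { zero → ≡.refl ; (suc j) → ≡.refl }) (λ { zero → ≡.refl ; (suc j) → ≡.refl }))))))
      where
      s : ∀ {n} → Fin n → Carrier
      s k = pow (- 1#) (toℕ k)
      b′ : Fin (suc (suc m)) → Fin (suc m) → Carrier
      b′ k l = b (X (suc (punchIn k l))) (Y (suc (punchIn k l)))
      term term′ : Fin (suc (suc m)) → Fin (suc m) → Carrier
      term  k l = s l * (b′ k l * W (removeAt (removeAt X (suc k)) (suc l)) (removeAt (removeAt Y (suc k)) (suc l)))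
      term′ k l = s l * (b′ k l * pinHead W (X zero) (Y zero) (removeAt (removeAt (tail X) k) l) (removeAt (removeAt (tail Y) k) l))

  expand-twice : ∀ m a b {W : Form m} → Extensional₂ W → ∀ X Y →
                 expand a (expand b W) X Y ≈ ordered m a b W X Y - ordered m b a W X Y
  expand-twice zero a b {W} W-ext X Y = begin
    expand a (expand b W) X Y                                                  ≈⟨ expand-twice-split a b W X Y ⟩
    headTerm a b W X Y + (- headTerm b a W X Y + lowerTerms a b W X Y)          ≈⟨ +-congˡ (+-congˡ (trans (+-identityʳ _) (trans (*-identityˡ _) (zeroʳ _)))) ⟩
    headTerm a b W X Y + (- headTerm b a W X Y + 0#)                           ≈⟨ +-congˡ (+-identityʳ _) ⟩
    headTerm a b W X Y - headTerm b a W X Y                                    ∎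
  expand-twice (suc m) a b {W} W-ext X Y = begin
    expand a (expand b W) X Y
      ≈⟨ expand-twice-split a b W X Y ⟩
    headTerm a b W X Y + (- headTerm b a W X Y + lowerTerms a b W X Y)
      ≈⟨ +-congˡ (+-congˡ (trans (lowerTerms-pinHead a b W-ext X Y) (expand-twice m a b (pinHead-extensional W-ext) (tail X) (tail Y)))) ⟩
    headTerm a b W X Y + (- headTerm b a W X Y + (ordered m a b W′ (tail X) (tail Y) - ordered m b a W′ (tail X) (tail Y)))
      ≈⟨ solve 4 (λ h₁ h₂ o₁ o₂ → h₁ :+ (:- h₂ :+ (o₁ :- o₂)) := (h₁ :+ o₁) :- (h₂ :+ o₂)) refl _ _ _ _ ⟩
    ordered (suc m) a b W X Y - ordered (suc m) b a W X Y ∎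
    where
    W′ : Form m
    W′ = pinHead W (X zero) (Y zero)
    pinHead-extensional : ∀ {m} {V : Form (suc m)} → Extensional₂ V → ∀ {x y} → Extensional₂ (pinHead V x y)
    pinHead-extensional V-ext U≗U′ V≗V′ = V-ext (λ { zero → ≡.refl ; (suc j) → U≗U′ j }) (λ { zero → ≡.refl ; (suc j) → V≗V′ j })

  laplace-repeated : ∀ m a (C : Vector Column m) X Y → laplace (suc (suc m)) (a ◂ a ◂ C) X Y ≈ 0#
  laplace-repeated m a C X Y = trans (expand-twice m a a (laplace-extensional m C) X Y) (-‿inverseʳ _)

  laplace-swap : ∀ m a b (C : Vector Column m) X Y →
                 laplace (suc (suc m)) (a ◂ b ◂ C) X Y ≈ - laplace (suc (suc m)) (b ◂ a ◂ C) X Y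
  laplace-swap m a b C X Y = begin
    laplace (suc (suc m)) (a ◂ b ◂ C) X Y      ≈⟨ expand-twice m a b (laplace-extensional m C) X Y ⟩
    ordered m a b W X Y - ordered m b a W X Y  ≈⟨ solve 2 (λ p q → p :- q := :- (q :- p)) refl _ _ ⟩
    - (ordered m b a W X Y - ordered m a b W X Y) ≈⟨ -‿cong (expand-twice m b a (laplace-extensional m C) X Y) ⟨
    - laplace (suc (suc m)) (b ◂ a ◂ C) X Y    ∎
    where
    W = laplace m C

  laplace-duplicate : ∀ m (C : Vector Column m) h (p : Fin m) → (∀ x y → C p x y ≈ h x y) →
                      ∀ X Y → laplace (suc m) (h ◂ C) X Y ≈ 0#
  laplace-duplicate (suc m) C h zero Cp≈h X Y = begin
    laplace (suc (suc m)) (h ◂ C) X Y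
      ≈⟨ laplace-cong (suc (suc m)) (h ◂ C) (h ◂ h ◂ tail C)
           (λ { zero x y → refl ; (suc zero) x y → Cp≈h x y ; (suc (suc j)) x y → refl }) X Y ⟩
    laplace (suc (suc m)) (h ◂ h ◂ tail C) X Y
      ≈⟨ laplace-repeated m h (tail C) X Y ⟩
    0# ∎
  laplace-duplicate (suc m) C h (suc p) Cp≈h X Y = begin
    laplace (suc (suc m)) (h ◂ C) X Y
      ≈⟨ laplace-cong (suc (suc m)) (h ◂ C) (h ◂ head C ◂ tail C)
           (λ { zero x y → refl ; (suc zero) x y → refl ; (suc (suc j)) x y → refl }) X Y ⟩
    laplace (suc (suc m)) (h ◂ head C ◂ tail C) X Y
      ≈⟨ laplace-swap m h (head C) (tail C) X Y ⟩
    - laplace (suc (suc m)) (head C ◂ h ◂ tail C) X Y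
      ≈⟨ -‿cong (expand-zero-form (head C) _ X Y (laplace-duplicate m (tail C) h p Cp≈h)) ⟩
    - 0#
      ≈⟨ -0#≈0# ⟩
    0# ∎

  laplace-last-to-front : ∀ m (C : Vector Column (suc m)) X Y →
                          laplace (suc m) (last C ◂ init C) X Y ≈ pow (- 1#) m * laplace (suc m) C X Y
  laplace-last-to-front zero    C X Y = trans (laplace-cong 1 (last C ◂ init C) C (λ { zero x y → refl }) X Y) (sym (*-identityˡ _))
  laplace-last-to-front (suc m) C X Y = begin
    laplace (suc (suc m)) (last C ◂ init C) X Y
      ≈⟨ laplace-cong (suc (suc m)) (last C ◂ init C) (last C ◂ head C ◂ init (tail C))
           (λ { zero x y → refl ; (suc zero) x y → refl ; (suc (suc j)) x y → refl }) X Y ⟩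
    laplace (suc (suc m)) (last C ◂ head C ◂ init (tail C)) X Y
      ≈⟨ laplace-swap m (last C) (head C) (init (tail C)) X Y ⟩
    - expand (head C) (laplace (suc m) (last (tail C) ◂ init (tail C))) X Y
      ≈⟨ -‿cong (expand-cong (λ _ → refl) (λ k → laplace-last-to-front m (tail C) (removeAt X k) (removeAt Y k))) ⟩
    - expand (head C) (λ U V → pow (- 1#) m * laplace (suc m) (tail C) U V) X Y
      ≈⟨ -‿cong (expand-scale (head C) (laplace (suc m) (tail C)) (pow (- 1#) m) X Y) ⟩
    - (pow (- 1#) m * laplace (suc (suc m)) C X Y)
      ≈⟨ -‿distribˡ-* _ _ ⟩
    - pow (- 1#) m * laplace (suc (suc m)) C X Y
      ≈⟨ *-congʳ (-1*x≈-x _) ⟨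
    pow (- 1#) (suc m) * laplace (suc (suc m)) C X Y ∎

module Determinant {c ℓ : Level} (R : CommutativeRing c ℓ) where
  open CommutativeRing R hiding (zero)
  open RingDefs R
  open Laplace R
  open Signs R using (Σ-Sym-by-preimage-of-zero; *-distribˡ-Σ-list)
  open ListSums +-commutativeMonoid using (sum; sum-cong-≋; ∑ₗ-cong)
  module ∏ = ListSums *-commutativeMonoid
  open import Relation.Binary.Reasoning.Setoid setoid

  det≈laplace : ∀ m (C : Vector Column m) X Y → det m (λ i j → C j (X i) (Y i)) ≈ laplace m C X Y
  det≈laplace zero    C X Y = trans (+-identityʳ _) (*-identityˡ _)
  det≈laplace (suc m) C X Y = begin
    Σ-list (Sym (suc m)) (λ σ → sgn σ * entries σ)
      ≈⟨ Σ-Sym-by-preimage-of-zero m entries-extensional ⟩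
    sum (λ k → pow (- 1#) (toℕ k) * Σ-list (Sym m) (λ τ → sgn τ * entries (insertAt (suc ∘ τ) k zero)))
      ≈⟨ sum-cong-≋ {x = λ k → pow (- 1#) (toℕ k) * Σ-list (Sym m) (λ τ → sgn τ * entries (insertAt (suc ∘ τ) k zero))}
                    {y = λ k → pow (- 1#) (toℕ k) * (C zero (X k) (Y k) * laplace m (tail C) (removeAt X k) (removeAt Y k))}
                    (λ k → *-congˡ (minor-expansion k)) ⟩
    sum (λ k → pow (- 1#) (toℕ k) * (C zero (X k) (Y k) * laplace m (tail C) (removeAt X k) (removeAt Y k)))
      ≡⟨ expand-sum (head C) (laplace m (tail C)) X Y ⟨
    laplace (suc m) C X Y ∎
    where
    entries : (Fin (suc m) → Fin (suc m)) → Carrier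
    entries σ = Π-list (allFin (suc m)) (λ i → C (σ i) (X i) (Y i))
    entries-extensional : ∀ {σ σ′} → σ ≗ σ′ → entries σ ≈ entries σ′
    entries-extensional σ≗σ′ = ∏.∑ₗ-cong (allFin (suc m)) λ i → reflexive (≡.cong (λ j → C j (X i) (Y i)) (σ≗σ′ i))
    minor-entries : ∀ k τ → entries (insertAt (suc ∘ τ) k zero) ≈
                            C zero (X k) (Y k) * Π-list (allFin m) (λ i → tail C (τ i) (removeAt X k i) (removeAt Y k i))
    minor-entries k τ = begin
      Π-list (allFin (suc m)) (λ i → C (σ i) (X i) (Y i))
        ≡⟨ ∏.∑ₗ-allFin (λ i → C (σ i) (X i) (Y i)) ⟩
      ∏.sum (λ i → C (σ i) (X i) (Y i))
        ≈⟨ ∏.sum-remove {i = k} (λ i → C (σ i) (X i) (Y i)) ⟩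
      C (σ k) (X k) (Y k) * ∏.sum (λ i → C (σ (punchIn k i)) (removeAt X k i) (removeAt Y k i))
        ≡⟨ ≡.cong₂ (λ j P → C j (X k) (Y k) * P) (insertAt-lookup (suc ∘ τ) k zero)
             (∏.sum-cong-≗ λ i → ≡.cong (λ j → C j (removeAt X k i) (removeAt Y k i)) (insertAt-punchIn (suc ∘ τ) k zero i)) ⟩
      C zero (X k) (Y k) * ∏.sum (λ i → tail C (τ i) (removeAt X k i) (removeAt Y k i))
        ≡⟨ ≡.cong (C zero (X k) (Y k) *_) (∏.∑ₗ-allFin (λ i → tail C (τ i) (removeAt X k i) (removeAt Y k i))) ⟨
      C zero (X k) (Y k) * Π-list (allFin m) (λ i → tail C (τ i) (removeAt X k i) (removeAt Y k i)) ∎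
      where
      σ = insertAt (suc ∘ τ) k zero
    minor-expansion : ∀ k → Σ-list (Sym m) (λ τ → sgn τ * entries (insertAt (suc ∘ τ) k zero)) ≈
                            C zero (X k) (Y k) * laplace m (tail C) (removeAt X k) (removeAt Y k)
    minor-expansion k = begin
      Σ-list (Sym m) (λ τ → sgn τ * entries (insertAt (suc ∘ τ) k zero))
        ≈⟨ ∑ₗ-cong (Sym m) (λ τ → trans (*-congˡ (minor-entries k τ)) (x∙yz≈y∙xz _ _ _)) ⟩
      Σ-list (Sym m) (λ τ → C zero (X k) (Y k) * (sgn τ * Π-list (allFin m) (λ i → tail C (τ i) (removeAt X k i) (removeAt Y k i))))
        ≈⟨ *-distribˡ-Σ-list _ (Sym m) _ ⟨
      C zero (X k) (Y k) * det m (λ i j → tail C j (removeAt X k i) (removeAt Y k i))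
        ≈⟨ *-congˡ (det≈laplace m (tail C) (removeAt X k) (removeAt Y k)) ⟩
      C zero (X k) (Y k) * laplace m (tail C) (removeAt X k) (removeAt Y k) ∎
      where open import Algebra.Properties.CommutativeSemigroup *-commutativeSemigroup using (x∙yz≈y∙xz)

module Staircase {c ℓ : Level} (R : CommutativeRing c ℓ) where
  open CommutativeRing R hiding (zero)
  open RingDefs R
  open Laplace R
  open Signs R using (Σ-Sym-by-image-of-zero; *-distribˡ-Σ-list)
  open ListSums +-commutativeMonoid using (sum; sum-cong-≋; ∑ₗ-cong)
  open ListSums *-commutativeMonoid using () renaming (sum to ∏; sum-cong-≋ to ∏-cong; sum-remove to ∏-remove;
    sum-cong-≗ to ∏-cong-≗; sum-reindex-injective to ∏-reindex-injective; ∑ₗ-filter to ∏ₗ-filter; ∑ₗ-allFin to ∏ₗ-allFin;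
    ∑ₗ-cong to ∏ₗ-cong; when to when*)
  open import Relation.Binary.Reasoning.Setoid setoid

  Π-i≤j≈∏∏ : ∀ n (f : Fin n → Fin n → Carrier) → Π-i≤j n f ≈ ∏ (λ i → ∏ λ j → when* (does (i ≤? j)) (f i j))
  Π-i≤j≈∏∏ n f = trans (reflexive (∏ₗ-allFin row)) (∏-cong λ i →
    trans (∏ₗ-filter (i ≤?_) (allFin n) (f i)) (reflexive (∏ₗ-allFin λ j → when* (does (i ≤? j)) (f i j))))
    where
    row : Fin n → Carrier
    row i = Π-list (filter (i ≤?_) (allFin n)) (f i)

  Π-i≤j-cong : ∀ n {f g : Fin n → Fin n → Carrier} → (∀ i j → f i j ≈ g i j) → Π-i≤j n f ≈ Π-i≤j n g
  Π-i≤j-cong n f≈g = ∏ₗ-cong (allFin n) λ i → ∏ₗ-cong (filter (i ≤?_) (allFin n)) (f≈g i)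

  Π-i≤j-suc : ∀ m (f : Fin (suc m) → Fin (suc m) → Carrier) →
              Π-i≤j (suc m) f ≈ ∏ (f zero) * Π-i≤j m (λ i j → f (suc i) (suc j))
  Π-i≤j-suc m f = begin
    Π-i≤j (suc m) f
      ≈⟨ Π-i≤j≈∏∏ (suc m) f ⟩
    ∏ (f zero) * ∏ (λ i → 1# * ∏ λ j → when* (does (suc i ≤? suc j)) (f (suc i) (suc j)))
      ≈⟨ *-congˡ (∏-cong {x = λ i → 1# * ∏ λ j → when* (does (suc i ≤? suc j)) (f (suc i) (suc j))}
                         {y = λ i → ∏ λ j → when* (does (i ≤? j)) (f (suc i) (suc j))}
           λ i → trans (*-identityˡ _) (reflexive (∏-cong-≗ λ j → ≡.cong (λ b → when* b (f (suc i) (suc j))) (suc≤?suc i j)))) ⟩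
    ∏ (f zero) * ∏ (λ i → ∏ λ j → when* (does (i ≤? j)) (f (suc i) (suc j)))
      ≈⟨ *-congˡ (Π-i≤j≈∏∏ m (λ i j → f (suc i) (suc j))) ⟨
    ∏ (f zero) * Π-i≤j m (λ i j → f (suc i) (suc j)) ∎
    where
    suc≤?suc : ∀ {n} (i j : Fin n) → does (suc i ≤? suc j) ≡ does (i ≤? j)
    suc≤?suc zero    j = ≡.refl
    suc≤?suc (suc i) j = ≡.refl

  staircase : ∀ m → Form m
  staircase m X Y = Σ-list (Sym m) (λ σ → sgn σ * Π-i≤j m (λ i j → Y (σ j) - X (σ i)))

  productColumn : ∀ {n} → Vector Carrier n → Column
  productColumn Y x _ = ∏ (λ l → Y l - x)

  staircase-expand : ∀ m X Y → staircase (suc m) X Y ≈ expand (productColumn Y) (staircase m) X Y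
  staircase-expand m X Y = begin
    staircase (suc m) X Y
      ≈⟨ Σ-Sym-by-image-of-zero m stairs-extensional ⟩
    sum (λ k → pow (- 1#) (toℕ k) * Σ-list (Sym m) (λ τ → sgn τ * stairs (k ◂ punchIn k ∘ τ)))
      ≈⟨ sum-cong-≋ {x = λ k → pow (- 1#) (toℕ k) * Σ-list (Sym m) (λ τ → sgn τ * stairs (k ◂ punchIn k ∘ τ))}
                    {y = λ k → pow (- 1#) (toℕ k) * (productColumn Y (X k) (Y k) * staircase m (removeAt X k) (removeAt Y k))}
                    (λ k → *-congˡ (minor-expansion k)) ⟩
    sum (λ k → pow (- 1#) (toℕ k) * (productColumn Y (X k) (Y k) * staircase m (removeAt X k) (removeAt Y k)))
      ≡⟨ expand-sum (productColumn Y) (staircase m) X Y ⟨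
    expand (productColumn Y) (staircase m) X Y ∎
    where
    open PermutationSums +-commutativeMonoid using (∑ₗ-Sym-cong)
    open import Algebra.Properties.CommutativeSemigroup *-commutativeSemigroup using (x∙yz≈y∙xz)
    stairs : (Fin (suc m) → Fin (suc m)) → Carrier
    stairs σ = Π-i≤j (suc m) (λ i j → Y (σ j) - X (σ i))
    stairs-extensional : ∀ {σ σ′} → σ ≗ σ′ → stairs σ ≈ stairs σ′
    stairs-extensional σ≗σ′ = Π-i≤j-cong (suc m) λ i j → reflexive (≡.cong₂ (λ a b → Y a - X b) (σ≗σ′ j) (σ≗σ′ i))
    first-row : ∀ k τ → Injectiveᶠ τ → ∏ (λ j → Y ((k ◂ punchIn k ∘ τ) j) - X k) ≈ productColumn Y (X k) (Y k)
    first-row k τ inj = begin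
      (Y k - X k) * ∏ (λ j → Y (punchIn k (τ j)) - X k) ≈⟨ *-congˡ (∏-reindex-injective τ inj (λ l → Y (punchIn k l) - X k)) ⟩
      (Y k - X k) * ∏ (λ l → Y (punchIn k l) - X k)     ≈⟨ ∏-remove (λ l → Y l - X k) ⟨
      ∏ (λ l → Y l - X k)                               ∎
    minor-expansion : ∀ k → Σ-list (Sym m) (λ τ → sgn τ * stairs (k ◂ punchIn k ∘ τ)) ≈
                            productColumn Y (X k) (Y k) * staircase m (removeAt X k) (removeAt Y k)
    minor-expansion k = trans
      (∑ₗ-Sym-cong m λ τ inj → trans (*-congˡ (trans (Π-i≤j-suc m _) (*-congʳ (first-row k τ inj)))) (x∙yz≈y∙xz _ _ _))
      (sym (*-distribˡ-Σ-list _ (Sym m) _))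

module PowerColumns {c ℓ : Level} (R : CommutativeRing c ℓ) where
  open CommutativeRing R hiding (zero)
  open RingDefs R
  open Laplace R
  open Staircase R using (productColumn)
  open ListSums *-commutativeMonoid using () renaming (sum to ∏; sum-remove to ∏-remove)
  open IntegerCoefficientSolver R using (solve; _:+_; _:*_; :-_; _:-_; _:=_; con)
  open import Algebra.Properties.Ring ring using (-1*x≈-x; -0#≈0#)
  open import Data.Vec.Base as Vec using (Vec; []; _∷_; _∷ʳ_; zipWith)
  open import Data.Integer.Base using (+_)
  open import Relation.Binary.Reasoning.Setoid setoid

  powerColumn : ℕ → Column
  powerColumn e x y = pow y (suc e) - pow x (suc e)

  powerColumns : ∀ m → Vector Column m
  powerColumns m j = powerColumn (toℕ j)

  horner : ∀ {r} → Vec Carrier r → Carrier → Carrier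
  horner []       x = 0#
  horner (a ∷ cs) x = a + x * horner cs x

  horner-zipWith-+ : ∀ {r} (u v : Vec Carrier r) x → horner (zipWith _+_ u v) x ≈ horner u x + horner v x
  horner-zipWith-+ []      []      x = sym (+-identityʳ 0#)
  horner-zipWith-+ (a ∷ u) (b ∷ v) x = trans (+-congˡ (*-congˡ (horner-zipWith-+ u v x)))
    (solve 5 (λ a b x hu hv → (a :+ b) :+ x :* (hu :+ hv) := (a :+ x :* hu) :+ (b :+ x :* hv)) refl a b x (horner u x) (horner v x))

  horner-map-* : ∀ {r} c (u : Vec Carrier r) x → horner (Vec.map (c *_) u) x ≈ c * horner u x
  horner-map-* c []      x = sym (zeroʳ c)
  horner-map-* c (a ∷ u) x = trans (+-congˡ (*-congˡ (horner-map-* c u x)))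
    (solve 4 (λ c a x h → c :* a :+ x :* (c :* h) := c :* (a :+ x :* h)) refl c a x (horner u x))

  horner-∷ʳ : ∀ {r} (u : Vec Carrier r) a x → horner (u ∷ʳ a) x ≈ horner u x + a * pow x r
  horner-∷ʳ []      a x = trans (+-congˡ (zeroʳ x)) (trans (+-identityʳ a) (sym (trans (+-identityˡ _) (*-identityʳ a))))
  horner-∷ʳ (b ∷ u) a x = trans (+-congˡ (*-congˡ (horner-∷ʳ u a x)))
    (solve 5 (λ b x h a p → b :+ x :* (h :+ a :* p) := (b :+ x :* h) :+ a :* (x :* p)) refl b x (horner u x) a _)

  ∏-linear-factors : ∀ n (Y : Vector Carrier n) →
                     Σ[ cs ∈ Vec Carrier n ] (∀ x → ∏ (λ l → Y l - x) ≈ pow (- 1#) n * pow x n + horner cs x)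
  ∏-linear-factors zero    Y = [] , λ x → sym (trans (+-identityʳ _) (*-identityˡ _))
  ∏-linear-factors (suc n) Y with ∏-linear-factors n (tail Y)
  ... | cs , ∏≈ = cs′ , λ x → begin
    (head Y - x) * ∏ (λ l → tail Y l - x)
      ≈⟨ *-congˡ (∏≈ x) ⟩
    (head Y - x) * (s * pow x n + horner cs x)
      ≈⟨ solve 5 (λ y x s p h → (y :- x) :* (s :* p :+ h) := (:- s) :* (x :* p) :+ (y :* (h :+ s :* p) :+ (con (+ 0) :+ x :* (:- h))))
           refl (head Y) x s (pow x n) (horner cs x) ⟩
    (- s) * (x * pow x n) + (head Y * (horner cs x + s * pow x n) + (0# + x * - horner cs x))
      ≈⟨ +-cong (*-congʳ (-1*x≈-x s)) (horner-cs′ x) ⟨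
    pow (- 1#) (suc n) * pow x (suc n) + horner cs′ x ∎
    where
    s = pow (- 1#) n
    cs′ : Vec Carrier (suc n)
    cs′ = zipWith _+_ (Vec.map (head Y *_) (cs ∷ʳ s)) (0# ∷ Vec.map (- 1# *_) cs)
    horner-cs′ : ∀ x → horner cs′ x ≈ head Y * (horner cs x + s * pow x n) + (0# + x * - horner cs x)
    horner-cs′ x = trans (horner-zipWith-+ (Vec.map (head Y *_) (cs ∷ʳ s)) (0# ∷ Vec.map (- 1# *_) cs) x)
      (+-cong (trans (horner-map-* (head Y) (cs ∷ʳ s) x) (*-congˡ (horner-∷ʳ cs s x)))
              (+-congˡ (*-congˡ (trans (horner-map-* (- 1#) cs x) (-1*x≈-x _)))))

  laplace-power-difference : ∀ m e → e ℕ.≤ m → ∀ X Y →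
                             laplace (suc m) ((λ x y → pow x e - pow y e) ◂ powerColumns m) X Y ≈ 0#
  laplace-power-difference m zero    _   X Y = expand-zero-column _ (laplace m (powerColumns m)) X Y λ _ → -‿inverseʳ 1#
  laplace-power-difference m (suc e) e<m X Y = begin
    expand (λ x y → pow x (suc e) - pow y (suc e)) (laplace m (powerColumns m)) X Y
      ≈⟨ expand-linear (laplace m (powerColumns m)) X Y (- 1#) _ (powerColumn e) (λ _ _ → 0#) (λ k →
           sym (trans (+-identityʳ _) (trans (-1*x≈-x _)
             (solve 2 (λ p q → :- (q :- p) := p :- q) refl (pow (X k) (suc e)) (pow (Y k) (suc e)))))) ⟩
    - 1# * laplace (suc m) (powerColumn e ◂ powerColumns m) X Y + expand (λ _ _ → 0#) (laplace m (powerColumns m)) X Y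
      ≈⟨ +-cong (*-congˡ (laplace-duplicate m (powerColumns m) (powerColumn e) (fromℕ< e<m)
                  (λ x y → reflexive (≡.cong (λ t → powerColumn t x y) (toℕ-fromℕ< e<m))) X Y))
                (expand-zero-column _ (laplace m (powerColumns m)) X Y (λ _ → refl)) ⟩
    - 1# * 0# + 0#
      ≈⟨ trans (+-identityʳ _) (zeroʳ _) ⟩
    0# ∎
    where open import Data.Fin.Base using (fromℕ<)
          open import Data.Fin.Properties using (toℕ-fromℕ<)

  laplace-horner-difference : ∀ m e {r} (cs : Vec Carrier r) → e ℕ.+ r ℕ.≤ suc m → ∀ X Y →
    laplace (suc m) ((λ x y → pow x e * horner cs x - pow y e * horner cs y) ◂ powerColumns m) X Y ≈ 0#
  laplace-horner-difference m e [] _ X Y = expand-zero-column _ (laplace m (powerColumns m)) X Y λ k →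
    solve 2 (λ p q → p :* con (+ 0) :- q :* con (+ 0) := con (+ 0)) refl (pow (X k) e) (pow (Y k) e)
  laplace-horner-difference m e (a ∷ cs) e+r<m X Y = begin
    expand column (laplace m (powerColumns m)) X Y
      ≈⟨ expand-linear (laplace m (powerColumns m)) X Y a column (λ x y → pow x e - pow y e) column′ (λ k →
           solve 7 (λ p q a x y h h′ → p :* (a :+ x :* h) :- q :* (a :+ y :* h′) := a :* (p :- q) :+ ((x :* p) :* h :- (y :* q) :* h′))
             refl (pow (X k) e) (pow (Y k) e) a (X k) (Y k) (horner cs (X k)) (horner cs (Y k))) ⟩
    a * laplace (suc m) ((λ x y → pow x e - pow y e) ◂ powerColumns m) X Y + laplace (suc m) (column′ ◂ powerColumns m) X Y
      ≈⟨ +-cong (*-congˡ (laplace-power-difference m e e≤m X Y)) (laplace-horner-difference m (suc e) cs e+r<m′ X Y) ⟩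
    a * 0# + 0#
      ≈⟨ trans (+-identityʳ _) (zeroʳ a) ⟩
    0# ∎
    where
    column column′ : Column
    column  x y = pow x e * horner (a ∷ cs) x - pow y e * horner (a ∷ cs) y
    column′ x y = pow x (suc e) * horner cs x - pow y (suc e) * horner cs y
    e+r<m′ : suc e ℕ.+ _ ℕ.≤ suc m
    e+r<m′ = ≡.subst (ℕ._≤ suc m) (ℕ.+-suc e _) e+r<m
    e≤m : e ℕ.≤ m
    e≤m = ℕ.≤-trans (ℕ.m≤m+n e _) (ℕ.s≤s⁻¹ e+r<m′)

  pow-1-squared : ∀ m → pow (- 1#) m * pow (- 1#) m ≈ 1#
  pow-1-squared zero    = *-identityˡ 1#
  pow-1-squared (suc m) = trans (*-cong (-1*x≈-x _) (-1*x≈-x _))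
    (trans (solve 1 (λ t → :- t :* :- t := t :* t) refl (pow (- 1#) m)) (pow-1-squared m))

  laplace-productColumn : ∀ m X (Y : Vector Carrier (suc m)) →
    laplace (suc m) (productColumn Y ◂ powerColumns m) X Y ≈ laplace (suc m) (powerColumns (suc m)) X Y
  laplace-productColumn m X Y with ∏-linear-factors (suc m) Y
  ... | cs , ∏≈ = begin
    expand (productColumn Y) (laplace m (powerColumns m)) X Y
      ≈⟨ expand-linear (laplace m (powerColumns m)) X Y (- s) (productColumn Y) (powerColumn m)
           (λ x y → pow x 0 * horner cs x - pow y 0 * horner cs y) row-k ⟩
    - s * laplace (suc m) (powerColumn m ◂ powerColumns m) X Y + laplace (suc m) (_ ◂ powerColumns m) X Y
      ≈⟨ +-cong (*-congˡ (trans (laplace-cong (suc m) _ (last G ◂ init G) moved X Y) (laplace-last-to-front m G X Y)))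
                (laplace-horner-difference m 0 cs ℕ.≤-refl X Y) ⟩
    - s * (t * laplace (suc m) G X Y) + 0#
      ≈⟨ trans (+-identityʳ _) (*-congʳ (-‿cong (-1*x≈-x t))) ⟩
    - - t * (t * laplace (suc m) G X Y)
      ≈⟨ solve 2 (λ t d → :- (:- t) :* (t :* d) := (t :* t) :* d) refl t (laplace (suc m) G X Y) ⟩
    (t * t) * laplace (suc m) G X Y
      ≈⟨ trans (*-congʳ (pow-1-squared m)) (*-identityˡ _) ⟩
    laplace (suc m) G X Y ∎
    where
    open import Data.Fin.Properties using (toℕ-fromℕ; toℕ-inject₁)
    G = powerColumns (suc m)
    t = pow (- 1#) m
    s = pow (- 1#) (suc m)
    moved : ∀ j x y → (powerColumn m ◂ powerColumns m) j x y ≈ (last G ◂ init G) j x y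
    moved zero    x y = reflexive (≡.cong (λ e → powerColumn e x y) (≡.sym (toℕ-fromℕ m)))
    moved (suc j) x y = reflexive (≡.cong (λ e → powerColumn e x y) (≡.sym (toℕ-inject₁ j)))
    vanishes-at-Y : ∀ k → productColumn Y (Y k) (Y k) ≈ 0#
    vanishes-at-Y k = trans (∏-remove (λ l → Y l - Y k)) (trans (*-congʳ (-‿inverseʳ (Y k))) (zeroˡ _))
    row-k : ∀ k → productColumn Y (X k) (Y k) ≈ - s * powerColumn m (X k) (Y k) + (pow (X k) 0 * horner cs (X k) - pow (Y k) 0 * horner cs (Y k))
    row-k k = begin
      productColumn Y (X k) (Y k)                                       ≈⟨ trans (+-congˡ (trans (-‿cong (vanishes-at-Y k)) -0#≈0#)) (+-identityʳ _) ⟨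
      productColumn Y (X k) (Y k) - productColumn Y (Y k) (Y k)         ≈⟨ +-cong (∏≈ (X k)) (-‿cong (∏≈ (Y k))) ⟩
      (s * pow (X k) (suc m) + horner cs (X k)) - (s * pow (Y k) (suc m) + horner cs (Y k))
        ≈⟨ solve 5 (λ s p q h h′ → (s :* p :+ h) :- (s :* q :+ h′) := (:- s) :* (q :- p) :+ (h :- h′)) refl s _ _ _ _ ⟩
      - s * powerColumn m (X k) (Y k) + (horner cs (X k) - horner cs (Y k))
        ≈⟨ +-congˡ (+-cong (*-identityˡ _) (-‿cong (*-identityˡ _))) ⟨
      - s * powerColumn m (X k) (Y k) + (pow (X k) 0 * horner cs (X k) - pow (Y k) 0 * horner cs (Y k)) ∎

module StaircaseDeterminant {c ℓ : Level} (R : CommutativeRing c ℓ) where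
  open CommutativeRing R hiding (zero)
  open Laplace R
  open Staircase R
  open PowerColumns R
  open import Relation.Binary.Reasoning.Setoid setoid

  staircase≈laplace : ∀ m X Y → staircase m X Y ≈ laplace m (powerColumns m) X Y
  staircase≈laplace zero    X Y = trans (+-identityʳ _) (*-identityˡ _)
  staircase≈laplace (suc m) X Y = begin
    staircase (suc m) X Y                                   ≈⟨ staircase-expand m X Y ⟩
    expand (productColumn Y) (staircase m) X Y              ≈⟨ expand-cong (λ _ → refl) (λ k → staircase≈laplace m (removeAt X k) (removeAt Y k)) ⟩
    laplace (suc m) (productColumn Y ◂ powerColumns m) X Y  ≈⟨ laplace-productColumn m X Y ⟩
    laplace (suc m) (powerColumns (suc m)) X Y              ∎

lemma4p1 : {c ℓ : Level} (R : CommutativeRing c ℓ) (n : ℕ) → 1 ≤ n →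
           (X Y : Fin n → CommutativeRing.Carrier R) →
           let open CommutativeRing R
               open RingDefs R
           in Σ-list (Sym n) (λ σ → sgn σ * Π-i≤j n (λ i j → Y (σ j) - X (σ i)))
              ≈ det n (λ i j → pow (Y i) (suc (toℕ j)) - pow (X i) (suc (toℕ j)))
lemma4p1 R n _ X Y = trans (staircase≈laplace n X Y) (sym (det≈laplace n (powerColumns n) X Y))
  where
  open CommutativeRing R
  open StaircaseDeterminant R
  open Determinant R
  open PowerColumns R
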